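{- Let $D$ be the $2n\times 2n$ diagonal matrix with $D_{ii}=D_{\tilde i\tilde i}=(-1)^{i-1}$ (rows/columns indexed in the order $1,\tilde1,\dots,n,\tilde n$). (1) Every subspace in $U_{\text{not shorted}}$ is the row span of a matrix $MD$, where $M$ is the $(n+1)\times 2n$ matrix whose first row is $(0,1,0,1,\dots,0,1)$ and whose $(i+1)$-st row ($1\le i\le n$) has entry $1$ in column $i$, entry $0$ in the other columns $j\in[n]$, and entry $S_{ij}$ in column $\tilde j$, for some real $n\times n$ matrix $S$. The matrix $S$ is unique up to adding a multiple of $(1,1,\dots,1)$ to each row, and the $n\times n$ matrix $P$ with entries $P_{ab}=S_{b,a-1}-S_{b,a}$ (indices modulo $n$, so $S_{b,0}=S_{b,n}$) is symmetric with all row and column sums $0$. Conversely, every symmetric $n\times n$ matrix with all row and column sums $0$ arises in this way from a unique point of $U_{\text{not shorted}}$. (2) Similarly, every subspace in $U_{\text{connected}}$ is the row span of a matrix $M'D$, where $M'$ is the $(n+1)\times 2n$ matrix whose first row is $(1,0,1,0,\dots,1,0)$ and whose $(i+1)$-st row ($1\le i\le n$) has entry $T_{ij}$ in column $j\in[n]$, entry $1$ in column $\tilde i$, and $0$ in the other columns $\tilde j$, for some real $n\times n$ matrix $T$, where the $n\times n$ matrix $Q$ with entries $Q_{ab}=T_{b,a+1}-T_{b,a}$ (indices modulo $n$) is symmetric with all row and column sums $0$.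
   Context: Let $V=\mathbb{R}^{2n}$ with basis $e_1,e_{\tilde 1},\dots,e_n,e_{\tilde n}$ ordered $1<\tilde1<2<\dots<n<\tilde n$; matrices representing points of $\mathrm{Gr}(n+1,2n)$ have columns in this order, and a point is the row span. For $I\subseteq[n]$, $\tilde I\subseteq[\tilde n]$ with $|I|+|\tilde I|=n+1$, $\Delta_{I,\tilde I}(X)$ is the maximal minor of a representing matrix in columns $I\sqcup\tilde I$ (Plücker coordinate, defined up to a common scalar). Let $\Omega$ be the skew form \[\Omega(x,y)=\sum_{i=1}^n(x_iy_{\tilde i}-x_{\tilde i}y_i)+\sum_{j=1}^{n-1}(x_{j+1}y_{\tilde j}-x_{\tilde j}y_{j+1})+(-1)^n(x_1y_{\tilde n}-x_{\tilde n}y_1),\] and $\mathrm{IG}^{\Omega}(n+1,2n)$ the set of $(n+1)$-dimensional subspaces isotropic for $\Omega$. $U_{\text{not shorted}}$ is the set of $X\in\mathrm{IG}^{\Omega}(n+1,2n)$ with $\Delta_{[n],\{\tilde k\}}(X)\neq0$ for all $k$, and $U_{\text{connected}}$ the set of $X\in\mathrm{IG}^{\Omega}(n+1,2n)$ with $\Delta_{\{k\},[\tilde n]}(X)\ne0$ for all $k$. -}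

module Defs where

open import Level using (0ℓ)
open import Data.Nat as ℕ using (ℕ; zero; suc)
open import Data.Nat.DivMod using (_mod_)
open import Data.Fin using (Fin; zero; suc; toℕ; inject₁; fromℕ; punchIn; _≟_)
open import Data.Bool using (Bool; true; false; if_then_else_)
open import Data.Product using (Σ; ∃; _×_; _,_)
open import Data.Sum using (_⊎_)
open import Relation.Nullary using (¬_)
open import Relation.Nullary.Decidable using (⌊_⌋)
open import Relation.Binary.PropositionalEquality using (_≡_; _≢_)
open import Algebra.Structures using (IsCommutativeRing)

-- The real numbers, axiomatised as a complete ordered field (this
-- characterises ℝ up to isomorphism).  Equality is propositional.

record RealField : Set₁ where
  infixl 6 _+_
  infixl 7 _*_
  infix 4 _<_
  field
    Carrier : Set
    0# 1#   : Carrier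
    _+_ _*_ : Carrier → Carrier → Carrier
    -_      : Carrier → Carrier
    isCommutativeRing : IsCommutativeRing _≡_ _+_ _*_ -_ 0# 1#
    0≢1     : 0# ≢ 1#
    inv     : (x : Carrier) → x ≢ 0# → Carrier
    inv-l   : (x : Carrier) (p : x ≢ 0#) → inv x p * x ≡ 1#
    _<_     : Carrier → Carrier → Set
    <-irrefl : ∀ x → ¬ (x < x)
    <-trans  : ∀ {x y z} → x < y → y < z → x < z
    <-tri    : ∀ x y → x < y ⊎ (x ≡ y ⊎ y < x)
    <-+      : ∀ {x y} z → x < y → x + z < y + z
    <-*      : ∀ {x y} → 0# < x → 0# < y → 0# < x * y
    lub : (A : Carrier → Set) → (∃ λ a → A a) →
          (∃ λ u → ∀ a → A a → (a < u ⊎ a ≡ u)) →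
          ∃ λ s → (∀ a → A a → (a < s ⊎ a ≡ s)) ×
                  (∀ u → (∀ a → A a → (a < u ⊎ a ≡ u)) → (s < u ⊎ s ≡ u))

module Setup (ℝ : RealField) where
  open RealField ℝ public

  infixl 6 _-_
  _-_ : Carrier → Carrier → Carrier
  x - y = x + (- y)

  sgn : ℕ → Carrier
  sgn zero = 1#
  sgn (suc k) = - sgn k

  sumFin : ∀ {k} → (Fin k → Carrier) → Carrier
  sumFin {zero} f = 0#
  sumFin {suc k} f = f zero + sumFin (λ i → f (suc i))

  det : ∀ {k} → (Fin k → Fin k → Carrier) → Carrier
  det {zero} A = 1#
  det {suc k} A = sumFin (λ j → sgn (toℕ j) * A zero j * det (λ r c → A (suc r) (punchIn j c)))

  -- Coordinates of V = ℝ^{2n}: column (i , false) is e_i,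
  -- column (i , true) is e_{ĩ}; indices 0-based (i ↦ i+1).
  Col : ℕ → Set
  Col n = Fin n × Bool

  -- an (n+1) × 2n matrix; a point of Gr(n+1,2n) is its row span
  Mat : ℕ → Set
  Mat n = Fin (suc n) → Col n → Carrier

  minor : ∀ {n} → Mat n → (Fin (suc n) → Col n) → Carrier
  minor A c = det (λ r s → A r (c s))

  FullRank : ∀ {n} → Mat n → Set
  FullRank {n} A = Σ (Fin (suc n) → Col n) λ c → minor A c ≢ 0#

  SameSpan : ∀ {n} → Mat n → Mat n → Set
  SameSpan {n} A B =
    (∃ λ (G : Fin (suc n) → Fin (suc n) → Carrier) →
        ∀ r c → A r c ≡ sumFin (λ k → G r k * B k c)) ×
    (∃ λ (H : Fin (suc n) → Fin (suc n) → Carrier) →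
        ∀ r c → B r c ≡ sumFin (λ k → H r k * A k c))

  csuc : ∀ {m} → Fin (suc m) → Fin (suc m)
  csuc {m} j = suc (toℕ j) mod suc m

  cpred : ∀ {m} → Fin (suc m) → Fin (suc m)
  cpred {m} j = (toℕ j ℕ.+ m) mod suc m

  Ω : ∀ {m} → (Col (suc m) → Carrier) → (Col (suc m) → Carrier) → Carrier
  Ω {m} x y =
      sumFin (λ i → x (i , false) * y (i , true) - x (i , true) * y (i , false))
    + sumFin (λ (j : Fin m) → x (suc j , false) * y (inject₁ j , true)
                             - x (inject₁ j , true) * y (suc j , false))
    + sgn (suc m) * (x (zero , false) * y (fromℕ m , true)
                     - x (fromℕ m , true) * y (zero , false))

  Isotropic : ∀ {m} → Mat (suc m) → Set
  Isotropic A = ∀ r s → Ω (A r) (A s) ≡ 0#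

  -- A represents a point of IG^Ω(n+1,2n)
  InIG : ∀ {m} → Mat (suc m) → Set
  InIG A = FullRank A × Isotropic A

  -- columns [n] ∪ {k̃} (listed as k̃,1,...,n; order only affects sign)
  colsNS : ∀ {n} → Fin n → Fin (suc n) → Col n
  colsNS k zero = k , true
  colsNS k (suc p) = p , false

  -- columns {k} ∪ [ñ] (listed as k,1̃,...,ñ)
  colsC : ∀ {n} → Fin n → Fin (suc n) → Col n
  colsC k zero = k , false
  colsC k (suc p) = p , true

  UNotShorted : ∀ {m} → Mat (suc m) → Set
  UNotShorted A = InIG A × (∀ k → minor A (colsNS k) ≢ 0#)

  UConnected : ∀ {m} → Mat (suc m) → Set
  UConnected A = InIG A × (∀ k → minor A (colsC k) ≢ 0#)

  Sq : ℕ → Set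
  Sq n = Fin n → Fin n → Carrier

  δ : ∀ {n} → Fin n → Fin n → Carrier
  δ i j = if ⌊ i ≟ j ⌋ then 1# else 0#

  -- right multiplication by D = diag((-1)^{i-1}) on both i and ĩ
  timesD : ∀ {n} → Mat n → Mat n
  timesD A r (i , b) = A r (i , b) * sgn (toℕ i)

  M : ∀ {n} → Sq n → Mat n
  M S zero (j , false) = 0#
  M S zero (j , true) = 1#
  M S (suc i) (j , false) = δ i j
  M S (suc i) (j , true) = S i j

  M′ : ∀ {n} → Sq n → Mat n
  M′ T zero (j , false) = 1#
  M′ T zero (j , true) = 0#
  M′ T (suc i) (j , false) = T i j
  M′ T (suc i) (j , true) = δ i j

  Pmat : ∀ {m} → Sq (suc m) → Sq (suc m)
  Pmat S a b = S b (cpred a) - S b a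

  Qmat : ∀ {m} → Sq (suc m) → Sq (suc m)
  Qmat T a b = T b (csuc a) - T b a

  SymZeroSums : ∀ {n} → Sq n → Set
  SymZeroSums P = (∀ a b → P a b ≡ P b a) ×
                  (∀ a → sumFin (λ b → P a b) ≡ 0#) ×
                  (∀ b → sumFin (λ a → P a b) ≡ 0#)

  RowShift : ∀ {n} → Sq n → Sq n → Set
  RowShift {n} S S′ = ∃ λ (c : Fin n → Carrier) → ∀ i j → S′ i j ≡ S i j + c i

-- A point of U_not shorted has Δ_{[n],{1̃}} ≠ 0, so inverting that maximal minor row-reduces a
-- representing matrix A to rows R₀,…,Rₙ that are unit vectors in the columns 1̃,1,…,n.  Isotropy
-- of R₀ against R₁,…,Rₙ forces the tilde entries of R₀ to alternate in sign, and the residual of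
-- each row of A after removing its components along the Rᵢ is isotropic against R₁,…,Rₙ and
-- vanishes in those columns, hence vanishes; after the sign change D the Rᵢ are the rows of M.
-- On rows a, b ≥ 1 of M D the form Ω evaluates to P_{ba} − P_{ab}, so isotropy is the symmetry of
-- P, and the column sums of P telescope around the cycle.  Two such matrices span the same space
-- exactly when the S differ by row shifts, and a symmetric P with zero sums is realised by the
-- tail sums S_{ba} = Σ_{a′ > a} P_{a′ b}.  Part (2) exchanges plain and tilde coordinates.  The
-- linear algebra needed is that a square matrix of nonzero determinant has a left inverse, which
-- rests on the vanishing of determinants with two equal rows.

module Submission where

open import Defs
open import Data.Nat as ℕ using (ℕ; zero; suc)
import Data.Nat.Properties as ℕ
import Data.Nat.DivMod as ℕ
open import Data.Integer as ℤ using (ℤ; -[1+_]; _◃_; sign; ∣_∣) renaming (+_ to pos)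
import Data.Integer.Properties as ℤ
open import Data.Sign as Sign using (Sign)
open import Data.Fin as Fin using (Fin; zero; suc; toℕ; inject₁; fromℕ; punchIn; punchOut)
import Data.Fin.Properties as Fin
open import Data.Bool using (true; false)
open import Data.Maybe using (just; nothing)
open import Data.Product using (Σ; ∃; _×_; _,_; proj₁; proj₂)
open import Data.Sum using (_⊎_; inj₁; inj₂)
open import Data.Empty using (⊥-elim)
open import Function using (_∘_)
open import Relation.Nullary using (yes; no; Dec)
open import Relation.Binary.Definitions using (WeaklyDecidable)
open import Relation.Binary.PropositionalEquality
open import Algebra.Bundles using (CommutativeRing; RawRing)
open import Algebra.Solver.Ring.AlmostCommutativeRing

module Arithmetic (ℝ : RealField) where
  open Setup ℝ public

  commutativeRing : CommutativeRing _ _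
  commutativeRing = record { isCommutativeRing = isCommutativeRing }

  open CommutativeRing commutativeRing public
    using ( +-assoc; +-comm; *-assoc; *-comm; +-identityˡ; +-identityʳ; *-identityˡ; *-identityʳ
          ; distribˡ; distribʳ; -‿inverseʳ; zeroˡ; zeroʳ; ring; +-group; semiring)
  open import Algebra.Properties.Ring ring public
    using (-‿distribˡ-*; -‿involutive; -‿+-comm; -0#≈0#)
  open import Algebra.Properties.Group +-group public
    using (x∙y⁻¹≈ε⇒x≈y; inverseˡ-unique)
  open import Algebra.Properties.Semiring.Mult semiring
    using (×-homo-+; idem-×-homo-*) renaming (_×_ to _·_)

  -- Integer coefficients for the ring solver.
  fromℤ : ℤ → Carrier
  fromℤ (pos n) = n · 1#
  fromℤ -[1+ n ] = - (suc n · 1#)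

  private
    fromSign : Sign → Carrier
    fromSign Sign.+ = 1#
    fromSign Sign.- = - 1#

    fromSign-* : ∀ s t → fromSign (s Sign.* t) ≡ fromSign s * fromSign t
    fromSign-* Sign.+ t = sym (*-identityˡ _)
    fromSign-* Sign.- Sign.+ = sym (*-identityʳ _)
    fromSign-* Sign.- Sign.- = begin
      1#            ≡⟨ sym (-‿involutive 1#) ⟩
      - - 1#        ≡⟨ cong -_ (sym (*-identityˡ _)) ⟩
      - (1# * - 1#) ≡⟨ -‿distribˡ-* 1# (- 1#) ⟩
      - 1# * - 1#   ∎
      where open ≡-Reasoning

    fromℤ-◃ : ∀ s n → fromℤ (s ◃ n) ≡ fromSign s * (n · 1#)
    fromℤ-◃ s zero = sym (zeroʳ _)
    fromℤ-◃ Sign.+ (suc n) = sym (*-identityˡ _)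
    fromℤ-◃ Sign.- (suc n) = trans (cong -_ (sym (*-identityˡ _))) (-‿distribˡ-* 1# _)

    fromℤ-signAbs : ∀ i → fromℤ i ≡ fromSign (sign i) * (∣ i ∣ · 1#)
    fromℤ-signAbs i = trans (cong fromℤ (sym (ℤ.◃-inverse i))) (fromℤ-◃ (sign i) ∣ i ∣)

    1+x-[1+y]≡x-y : ∀ x y → (1# + x) - (1# + y) ≡ x - y
    1+x-[1+y]≡x-y x y = begin
      (1# + x) + - (1# + y)     ≡⟨ cong ((1# + x) +_) (sym (-‿+-comm 1# y)) ⟩
      (1# + x) + (- 1# + - y)   ≡⟨ +-assoc 1# x _ ⟩
      1# + (x + (- 1# + - y))   ≡⟨ cong (1# +_) (sym (+-assoc x _ _)) ⟩
      1# + ((x + - 1#) + - y)   ≡⟨ cong (λ z → 1# + (z + - y)) (+-comm x _) ⟩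
      1# + ((- 1# + x) + - y)   ≡⟨ cong (1# +_) (+-assoc _ x _) ⟩
      1# + (- 1# + (x + - y))   ≡⟨ sym (+-assoc _ _ _) ⟩
      (1# + - 1#) + (x + - y)   ≡⟨ cong (_+ (x + - y)) (-‿inverseʳ 1#) ⟩
      0# + (x + - y)            ≡⟨ +-identityˡ _ ⟩
      x + - y                   ∎
      where open ≡-Reasoning

    fromℤ-⊖ : ∀ m n → fromℤ (m ℤ.⊖ n) ≡ m · 1# - n · 1#
    fromℤ-⊖ m zero = begin
      fromℤ (m ℤ.⊖ 0)   ≡⟨ cong fromℤ (ℤ.⊖-≥ {m} ℕ.z≤n) ⟩
      m · 1#            ≡⟨ sym (+-identityʳ _) ⟩
      m · 1# + 0#       ≡⟨ cong (m · 1# +_) (sym -0#≈0#) ⟩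
      m · 1# - 0#       ∎
      where open ≡-Reasoning
    fromℤ-⊖ zero (suc n) = sym (+-identityˡ _)
    fromℤ-⊖ (suc m) (suc n) =
      trans (cong fromℤ (ℤ.[1+m]⊖[1+n]≡m⊖n m n))
            (trans (fromℤ-⊖ m n) (sym (1+x-[1+y]≡x-y (m · 1#) (n · 1#))))

  fromℤ-+ : ∀ i j → fromℤ (i ℤ.+ j) ≡ fromℤ i + fromℤ j
  fromℤ-+ -[1+ m ] -[1+ n ] = begin
    - (suc (suc m ℕ.+ n) · 1#)            ≡⟨ cong (λ k → - (suc k · 1#)) (sym (ℕ.+-suc m n)) ⟩
    - ((suc m ℕ.+ suc n) · 1#)            ≡⟨ cong -_ (×-homo-+ 1# (suc m) (suc n)) ⟩
    - (suc m · 1# + suc n · 1#)           ≡⟨ sym (-‿+-comm _ _) ⟩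
    - (suc m · 1#) + - (suc n · 1#)       ∎
    where open ≡-Reasoning
  fromℤ-+ -[1+ m ] (pos n) = trans (fromℤ-⊖ n (suc m)) (+-comm _ _)
  fromℤ-+ (pos m) -[1+ n ] = fromℤ-⊖ m (suc n)
  fromℤ-+ (pos m) (pos n) = ×-homo-+ 1# m n

  fromℤ-neg : ∀ i → fromℤ (ℤ.- i) ≡ - fromℤ i
  fromℤ-neg (pos zero) = sym -0#≈0#
  fromℤ-neg (pos (suc n)) = refl
  fromℤ-neg -[1+ n ] = sym (-‿involutive _)

  fromℤ-* : ∀ i j → fromℤ (i ℤ.* j) ≡ fromℤ i * fromℤ j
  fromℤ-* i j = begin
    fromℤ ((sign i Sign.* sign j) ◃ (∣ i ∣ ℕ.* ∣ j ∣))
      ≡⟨ fromℤ-◃ (sign i Sign.* sign j) (∣ i ∣ ℕ.* ∣ j ∣) ⟩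
    fromSign (sign i Sign.* sign j) * ((∣ i ∣ ℕ.* ∣ j ∣) · 1#)
      ≡⟨ cong₂ _*_ (fromSign-* (sign i) (sign j)) (sym (idem-×-homo-* ∣ i ∣ ∣ j ∣ (*-identityˡ 1#))) ⟩
    (fromSign (sign i) * fromSign (sign j)) * ((∣ i ∣ · 1#) * (∣ j ∣ · 1#))
      ≡⟨ interchange _ _ _ _ ⟩
    (fromSign (sign i) * (∣ i ∣ · 1#)) * (fromSign (sign j) * (∣ j ∣ · 1#))
      ≡⟨ sym (cong₂ _*_ (fromℤ-signAbs i) (fromℤ-signAbs j)) ⟩
    fromℤ i * fromℤ j ∎
    where
      open ≡-Reasoning
      interchange : ∀ a b c d → (a * b) * (c * d) ≡ (a * c) * (b * d)
      interchange a b c d = begin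
        (a * b) * (c * d) ≡⟨ *-assoc a b _ ⟩
        a * (b * (c * d)) ≡⟨ cong (a *_) (sym (*-assoc b c d)) ⟩
        a * ((b * c) * d) ≡⟨ cong (λ x → a * (x * d)) (*-comm b c) ⟩
        a * ((c * b) * d) ≡⟨ cong (a *_) (*-assoc c b d) ⟩
        a * (c * (b * d)) ≡⟨ sym (*-assoc a c _) ⟩
        (a * c) * (b * d) ∎

  ℤ-rawRing : RawRing _ _
  ℤ-rawRing = record
    { Carrier = ℤ ; _≈_ = _≡_ ; _+_ = ℤ._+_ ; _*_ = ℤ._*_ ; -_ = ℤ.-_ ; 0# = pos 0 ; 1# = pos 1 }

  fromℤ-morphism : ℤ-rawRing -Raw-AlmostCommutative⟶ fromCommutativeRing commutativeRing
  fromℤ-morphism = record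
    { ⟦_⟧ = fromℤ ; +-homo = fromℤ-+ ; *-homo = fromℤ-* ; -‿homo = fromℤ-neg
    ; 0-homo = refl ; 1-homo = +-identityʳ 1# }

  fromℤ-≟ : WeaklyDecidable (Induced-equivalence fromℤ-morphism)
  fromℤ-≟ i j with i ℤ.≟ j
  ... | yes i≡j = just (cong fromℤ i≡j)
  ... | no _ = nothing

  open import Algebra.Solver.Ring ℤ-rawRing (fromCommutativeRing commutativeRing) fromℤ-morphism fromℤ-≟ public
    using (solve; _:=_; _:+_; _:*_; :-_; _:-_)

  _≟_ : (x y : Carrier) → Dec (x ≡ y)
  x ≟ y with <-tri x y
  ... | inj₁ x<y = no (λ x≡y → <-irrefl y (subst (_< y) x≡y x<y))
  ... | inj₂ (inj₁ x≡y) = yes x≡y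
  ... | inj₂ (inj₂ y<x) = no (λ x≡y → <-irrefl y (subst (y <_) x≡y y<x))

  x-y≡0⇒x≡y : ∀ {x y} → x - y ≡ 0# → x ≡ y
  x-y≡0⇒x≡y = x∙y⁻¹≈ε⇒x≈y _ _

  x+y≡0⇒x≡-y : ∀ {x y} → x + y ≡ 0# → x ≡ - y
  x+y≡0⇒x≡-y = inverseˡ-unique _ _

  -x≡0⇒x≡0 : ∀ {x} → - x ≡ 0# → x ≡ 0#
  -x≡0⇒x≡0 {x} -x≡0 = trans (sym (-‿involutive x)) (trans (cong -_ -x≡0) -0#≈0#)

  x*y≡0⇒x≡0⊎y≡0 : ∀ {x y} → x * y ≡ 0# → x ≡ 0# ⊎ y ≡ 0#
  x*y≡0⇒x≡0⊎y≡0 {x} {y} xy≡0 with x ≟ 0#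
  ... | yes x≡0 = inj₁ x≡0
  ... | no x≢0 = inj₂ (begin
    y                   ≡⟨ sym (*-identityˡ y) ⟩
    1# * y              ≡⟨ cong (_* y) (sym (inv-l x x≢0)) ⟩
    (inv x x≢0 * x) * y ≡⟨ *-assoc _ _ _ ⟩
    inv x x≢0 * (x * y) ≡⟨ cong (inv x x≢0 *_) xy≡0 ⟩
    inv x x≢0 * 0#      ≡⟨ zeroʳ _ ⟩
    0#                  ∎)
    where open ≡-Reasoning

  *-≢0 : ∀ {x y} → x ≢ 0# → y ≢ 0# → x * y ≢ 0#
  *-≢0 x≢0 y≢0 xy≡0 with x*y≡0⇒x≡0⊎y≡0 xy≡0
  ... | inj₁ x≡0 = x≢0 x≡0
  ... | inj₂ y≡0 = y≢0 y≡0

  x*y≢0⇒y≢0 : ∀ {x y} → x * y ≢ 0# → y ≢ 0#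
  x*y≢0⇒y≢0 {x} xy≢0 y≡0 = xy≢0 (trans (cong (x *_) y≡0) (zeroʳ x))

  *-cancelˡ : ∀ {c x y} → c ≢ 0# → c * x ≡ c * y → x ≡ y
  *-cancelˡ {c} {x} {y} c≢0 cx≡cy with x*y≡0⇒x≡0⊎y≡0 c[x-y]≡0
    where
      c[x-y]≡0 : c * (x - y) ≡ 0#
      c[x-y]≡0 = trans (solve 3 (λ c x y → c :* (x :- y) := c :* x :- c :* y) refl c x y)
                       (trans (cong (_- c * y) cx≡cy) (-‿inverseʳ _))
  ... | inj₁ c≡0 = ⊥-elim (c≢0 c≡0)
  ... | inj₂ x-y≡0 = x-y≡0⇒x≡y x-y≡0

  1≢0 : 1# ≢ 0#
  1≢0 1≡0 = 0≢1 (sym 1≡0)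

  0<1 : 0# < 1#
  0<1 with <-tri 0# 1#
  ... | inj₁ 0<1 = 0<1
  ... | inj₂ (inj₁ 0≡1) = ⊥-elim (0≢1 0≡1)
  ... | inj₂ (inj₂ 1<0) = ⊥-elim (<-irrefl 1# (<-trans 1<0 0<[-1]²))
    where
      0<-1 : 0# < - 1#
      0<-1 = subst₂ _<_ (-‿inverseʳ 1#) (+-identityˡ (- 1#)) (<-+ (- 1#) 1<0)
      [-1]²≡1 : - 1# * - 1# ≡ 1#
      [-1]²≡1 = trans (sym (-‿distribˡ-* 1# (- 1#))) (trans (cong -_ (*-identityˡ _)) (-‿involutive 1#))
      0<[-1]² : 0# < 1#
      0<[-1]² = subst (0# <_) [-1]²≡1 (<-* 0<-1 0<-1)

  1+1≢0 : 1# + 1# ≢ 0#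
  1+1≢0 2≡0 = <-irrefl 0# (<-trans 0<1 (subst (1# <_) 2≡0 1<2))
    where
      1<2 : 1# < 1# + 1#
      1<2 = subst (_< 1# + 1#) (+-identityˡ 1#) (<-+ 1# 0<1)

  x≡-x⇒x≡0 : ∀ {x} → x ≡ - x → x ≡ 0#
  x≡-x⇒x≡0 {x} x≡-x with x*y≡0⇒x≡0⊎y≡0 {1# + 1#} {x} [1+1]x≡0
    where
      [1+1]x≡0 : (1# + 1#) * x ≡ 0#
      [1+1]x≡0 = begin
        (1# + 1#) * x ≡⟨ trans (distribʳ x 1# 1#) (cong₂ _+_ (*-identityˡ x) (*-identityˡ x)) ⟩
        x + x         ≡⟨ cong (x +_) x≡-x ⟩
        x + - x       ≡⟨ -‿inverseʳ x ⟩
        0#            ∎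
        where open ≡-Reasoning
  ... | inj₁ 2≡0 = ⊥-elim (1+1≢0 2≡0)
  ... | inj₂ x≡0 = x≡0

module Sums (ℝ : RealField) where
  open Arithmetic ℝ public

  sgn²≡1 : ∀ k → sgn k * sgn k ≡ 1#
  sgn²≡1 zero = *-identityˡ 1#
  sgn²≡1 (suc k) = trans (solve 1 (λ s → (:- s) :* (:- s) := s :* s) refl (sgn k)) (sgn²≡1 k)

  sgn≢0 : ∀ k → sgn k ≢ 0#
  sgn≢0 k sgn≡0 = 0≢1 (begin
    0#            ≡⟨ sym (zeroˡ (sgn k)) ⟩
    0# * sgn k    ≡⟨ cong (_* sgn k) (sym sgn≡0) ⟩
    sgn k * sgn k ≡⟨ sgn²≡1 k ⟩
    1#            ∎)
    where open ≡-Reasoning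

  sum-cong : ∀ {k} {f g : Fin k → Carrier} → (∀ i → f i ≡ g i) → sumFin f ≡ sumFin g
  sum-cong {zero} f≗g = refl
  sum-cong {suc k} f≗g = cong₂ _+_ (f≗g zero) (sum-cong (λ i → f≗g (suc i)))

  sum-zeros : ∀ {k} {f : Fin k → Carrier} → (∀ i → f i ≡ 0#) → sumFin f ≡ 0#
  sum-zeros {zero} f≗0 = refl
  sum-zeros {suc k} f≗0 = trans (cong₂ _+_ (f≗0 zero) (sum-zeros (λ i → f≗0 (suc i)))) (+-identityˡ 0#)

  sum-+ : ∀ {k} (f g : Fin k → Carrier) → sumFin (λ i → f i + g i) ≡ sumFin f + sumFin g
  sum-+ {zero} f g = sym (+-identityˡ 0#)
  sum-+ {suc k} f g =
    trans (cong ((f zero + g zero) +_) (sum-+ (λ i → f (suc i)) (λ i → g (suc i))))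
          (solve 4 (λ a b c d → (a :+ b) :+ (c :+ d) := (a :+ c) :+ (b :+ d)) refl (f zero) (g zero) _ _)

  sum-*ˡ : ∀ {k} c (f : Fin k → Carrier) → sumFin (λ i → c * f i) ≡ c * sumFin f
  sum-*ˡ {zero} c f = sym (zeroʳ c)
  sum-*ˡ {suc k} c f = trans (cong ((c * f zero) +_) (sum-*ˡ c (λ i → f (suc i)))) (sym (distribˡ c _ _))

  sum-*ʳ : ∀ {k} c (f : Fin k → Carrier) → sumFin (λ i → f i * c) ≡ sumFin f * c
  sum-*ʳ c f = trans (sum-cong (λ i → *-comm (f i) c)) (trans (sum-*ˡ c f) (*-comm c _))

  sum-*ˡ-assoc : ∀ {k} c (f g : Fin k → Carrier) → sumFin (λ i → c * f i * g i) ≡ c * sumFin (λ i → f i * g i)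
  sum-*ˡ-assoc c f g = trans (sum-cong (λ i → *-assoc c (f i) (g i))) (sum-*ˡ c (λ i → f i * g i))

  sum-neg : ∀ {k} (f : Fin k → Carrier) → sumFin (λ i → - f i) ≡ - sumFin f
  sum-neg {zero} f = sym -0#≈0#
  sum-neg {suc k} f = trans (cong ((- f zero) +_) (sum-neg (λ i → f (suc i)))) (-‿+-comm _ _)

  sum-difference : ∀ {k} (f g : Fin k → Carrier) → sumFin (λ i → f i - g i) ≡ sumFin f - sumFin g
  sum-difference f g = trans (sum-+ f (λ i → - g i)) (cong (sumFin f +_) (sum-neg g))

  sum-comm : ∀ {k l} (f : Fin k → Fin l → Carrier) →
    sumFin (λ i → sumFin (λ j → f i j)) ≡ sumFin (λ j → sumFin (λ i → f i j))
  sum-comm {zero} {l} f = sym (sum-zeros {l} (λ j → refl))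
  sum-comm {suc k} {l} f =
    trans (cong (sumFin (f zero) +_) (sum-comm (λ i j → f (suc i) j)))
          (sym (sum-+ (λ j → f zero j) (λ j → sumFin (λ i → f (suc i) j))))

  sum-init-last : ∀ {k} (f : Fin (suc k) → Carrier) →
    sumFin f ≡ sumFin (λ j → f (inject₁ j)) + f (fromℕ k)
  sum-init-last {zero} f = +-comm _ _
  sum-init-last {suc k} f = trans (cong (f zero +_) (sum-init-last (λ i → f (suc i)))) (sym (+-assoc _ _ _))

  sum-remove : ∀ {k} (f : Fin (suc k) → Carrier) (j : Fin (suc k)) →
    sumFin f ≡ f j + sumFin (λ l → f (punchIn j l))
  sum-remove f zero = refl
  sum-remove {suc k} f (suc j) =
    trans (cong (f zero +_) (sum-remove (λ i → f (suc i)) j))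
          (solve 3 (λ a b c → a :+ (b :+ c) := b :+ (a :+ c)) refl (f zero) (f (suc j)) _)

  sum-supported-at : ∀ {k} (f : Fin k → Carrier) (j : Fin k) → (∀ i → i ≢ j → f i ≡ 0#) → sumFin f ≡ f j
  sum-supported-at {suc k} f j f≡0 = begin
    sumFin f                                ≡⟨ sum-remove f j ⟩
    f j + sumFin (λ l → f (punchIn j l))    ≡⟨ cong (f j +_) (sum-zeros (λ l → f≡0 _ (Fin.punchInᵢ≢i j l))) ⟩
    f j + 0#                                ≡⟨ +-identityʳ _ ⟩
    f j                                     ∎
    where open ≡-Reasoning

  sum≢0⇒∃≢0 : ∀ {k} (f : Fin k → Carrier) → sumFin f ≢ 0# → ∃ λ i → f i ≢ 0#
  sum≢0⇒∃≢0 {zero} f sum≢0 = ⊥-elim (sum≢0 refl)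
  sum≢0⇒∃≢0 {suc k} f sum≢0 with f zero ≟ 0#
  ... | no f0≢0 = zero , f0≢0
  ... | yes f0≡0 with sum≢0⇒∃≢0 (λ i → f (suc i)) (λ rest≡0 → sum≢0 (trans (cong₂ _+_ f0≡0 rest≡0) (+-identityˡ 0#)))
  ... | i , fi≢0 = suc i , fi≢0

  δ-refl : ∀ {k} (i : Fin k) → δ i i ≡ 1#
  δ-refl i with i Fin.≟ i
  ... | yes _ = refl
  ... | no i≢i = ⊥-elim (i≢i refl)

  δ-≢ : ∀ {k} {i j : Fin k} → i ≢ j → δ i j ≡ 0#
  δ-≢ {i = i} {j} i≢j with i Fin.≟ j
  ... | yes i≡j = ⊥-elim (i≢j i≡j)
  ... | no _ = refl

  δ-sym : ∀ {k} (i j : Fin k) → δ i j ≡ δ j i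
  δ-sym i j with i Fin.≟ j
  ... | yes refl = sym (δ-refl i)
  ... | no i≢j = sym (δ-≢ (i≢j ∘ sym))

  δ-suc : ∀ {k} (i j : Fin k) → δ (suc i) (suc j) ≡ δ i j
  δ-suc i j with i Fin.≟ j
  ... | yes refl = refl
  ... | no _ = refl

  δ-zero-suc : ∀ {k} (j : Fin k) → δ {suc k} zero (suc j) ≡ 0#
  δ-zero-suc j = δ-≢ {i = zero} {j = suc j} λ ()

  sum-δʳ : ∀ {k} (f : Fin k → Carrier) (t : Fin k) → sumFin (λ i → f i * δ i t) ≡ f t
  sum-δʳ f t = begin
    sumFin (λ i → f i * δ i t) ≡⟨ sum-supported-at _ t (λ i i≢t → trans (cong (f i *_) (δ-≢ i≢t)) (zeroʳ _)) ⟩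
    f t * δ t t                ≡⟨ cong (f t *_) (δ-refl t) ⟩
    f t * 1#                   ≡⟨ *-identityʳ _ ⟩
    f t                        ∎
    where open ≡-Reasoning

  sum-δˡ : ∀ {k} (f : Fin k → Carrier) (t : Fin k) → sumFin (λ i → δ t i * f i) ≡ f t
  sum-δˡ f t = trans (sum-cong (λ i → trans (*-comm _ _) (cong (f i *_) (δ-sym t i)))) (sum-δʳ f t)

  δ-* : ∀ {k} (i j : Fin k) (g : Fin k → Carrier) → δ i j * g j ≡ g i * δ i j
  δ-* i j g with i Fin.≟ j
  ... | yes refl = *-comm _ _
  ... | no _ = trans (zeroˡ _) (sym (zeroʳ _))

  cpred-zero : ∀ {m} → cpred {m} zero ≡ fromℕ m
  cpred-zero {m} = Fin.toℕ-injective (begin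
    toℕ (m ℕ.mod suc m) ≡⟨ Fin.toℕ-fromℕ< _ ⟩
    m ℕ.% suc m         ≡⟨ ℕ.m<n⇒m%n≡m (ℕ.n<1+n m) ⟩
    m                   ≡⟨ sym (Fin.toℕ-fromℕ m) ⟩
    toℕ (fromℕ m)       ∎)
    where open ≡-Reasoning

  cpred-suc : ∀ {m} (j : Fin m) → cpred {m} (suc j) ≡ inject₁ j
  cpred-suc {m} j = Fin.toℕ-injective (begin
    toℕ ((suc (toℕ j) ℕ.+ m) ℕ.mod suc m) ≡⟨ Fin.toℕ-fromℕ< _ ⟩
    (suc (toℕ j) ℕ.+ m) ℕ.% suc m         ≡⟨ cong (ℕ._% suc m) (sym (ℕ.+-suc (toℕ j) m)) ⟩
    (toℕ j ℕ.+ suc m) ℕ.% suc m           ≡⟨ ℕ.[m+n]%n≡m%n (toℕ j) (suc m) ⟩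
    toℕ j ℕ.% suc m                       ≡⟨ ℕ.m<n⇒m%n≡m (ℕ.<-trans (Fin.toℕ<n j) (ℕ.n<1+n m)) ⟩
    toℕ j                                 ≡⟨ sym (Fin.toℕ-inject₁ j) ⟩
    toℕ (inject₁ j)                       ∎)
    where open ≡-Reasoning

  csuc-fromℕ : ∀ {m} → csuc {m} (fromℕ m) ≡ zero
  csuc-fromℕ {m} = Fin.toℕ-injective (begin
    toℕ (suc (toℕ (fromℕ m)) ℕ.mod suc m) ≡⟨ Fin.toℕ-fromℕ< _ ⟩
    suc (toℕ (fromℕ m)) ℕ.% suc m         ≡⟨ cong (λ k → suc k ℕ.% suc m) (Fin.toℕ-fromℕ m) ⟩
    suc m ℕ.% suc m                       ≡⟨ ℕ.n%n≡0 (suc m) ⟩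
    0                                     ∎)
    where open ≡-Reasoning

  csuc-inject₁ : ∀ {m} (j : Fin m) → csuc {m} (inject₁ j) ≡ suc j
  csuc-inject₁ {m} j = Fin.toℕ-injective (begin
    toℕ (suc (toℕ (inject₁ j)) ℕ.mod suc m) ≡⟨ Fin.toℕ-fromℕ< _ ⟩
    suc (toℕ (inject₁ j)) ℕ.% suc m         ≡⟨ cong (λ k → suc k ℕ.% suc m) (Fin.toℕ-inject₁ j) ⟩
    suc (toℕ j) ℕ.% suc m                   ≡⟨ ℕ.m<n⇒m%n≡m (ℕ.s≤s (Fin.toℕ<n j)) ⟩
    suc (toℕ j)                             ∎)
    where open ≡-Reasoning

  sum-cpred : ∀ {m} (f : Fin (suc m) → Carrier) → sumFin (λ a → f (cpred a)) ≡ sumFin f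
  sum-cpred {m} f = begin
    f (cpred zero) + sumFin (λ j → f (cpred (suc j))) ≡⟨ cong₂ _+_ (cong f cpred-zero) (sum-cong (λ j → cong f (cpred-suc j))) ⟩
    f (fromℕ m) + sumFin (λ j → f (inject₁ j))        ≡⟨ +-comm _ _ ⟩
    sumFin (λ j → f (inject₁ j)) + f (fromℕ m)        ≡⟨ sym (sum-init-last f) ⟩
    sumFin f                                          ∎
    where open ≡-Reasoning

  sum-csuc : ∀ {m} (f : Fin (suc m) → Carrier) → sumFin (λ a → f (csuc a)) ≡ sumFin f
  sum-csuc {m} f = begin
    sumFin (λ a → f (csuc a))                                ≡⟨ sum-init-last (λ a → f (csuc a)) ⟩
    sumFin (λ j → f (csuc (inject₁ j))) + f (csuc (fromℕ m)) ≡⟨ cong₂ _+_ (sum-cong (λ j → cong f (csuc-inject₁ j))) (cong f csuc-fromℕ) ⟩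
    sumFin (λ j → f (suc j)) + f zero                        ≡⟨ +-comm _ _ ⟩
    sumFin f                                                 ∎
    where open ≡-Reasoning

  alternating : ∀ {m} (f : Fin (suc m) → Carrier) → (∀ (j : Fin m) → f (suc j) ≡ - f (inject₁ j)) →
    ∀ j → f j ≡ sgn (toℕ j) * f zero
  alternating f step zero = sym (*-identityˡ _)
  alternating {suc m} f step (suc j) = begin
    f (suc j)                  ≡⟨ step j ⟩
    - f (inject₁ j)            ≡⟨ cong -_ (alternating (λ i → f (inject₁ i)) (λ i → step (inject₁ i)) j) ⟩
    - (sgn (toℕ j) * f zero)   ≡⟨ -‿distribˡ-* _ _ ⟩
    sgn (suc (toℕ j)) * f zero ∎
    where open ≡-Reasoning

  constant : ∀ {m} (f : Fin (suc m) → Carrier) → (∀ (j : Fin m) → f (suc j) ≡ f (inject₁ j)) →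
    ∀ j → f j ≡ f zero
  constant f step zero = refl
  constant {suc m} f step (suc j) = trans (step j) (constant (λ i → f (inject₁ i)) (λ i → step (inject₁ i)) j)

module Determinant (ℝ : RealField) where
  open Sums ℝ public

  minor₀ : ∀ {k} → Sq (suc k) → Fin (suc k) → Sq k
  minor₀ A j r c = A (suc r) (punchIn j c)

  cofactor : ∀ {k} → Sq (suc k) → Fin (suc k) → Carrier
  cofactor A j = sgn (toℕ j) * det (minor₀ A j)

  det-cong : ∀ {k} {A B : Sq k} → (∀ r c → A r c ≡ B r c) → det A ≡ det B
  det-cong {zero} A≗B = refl
  det-cong {suc k} A≗B = sum-cong λ j →
    cong₂ _*_ (cong (sgn (toℕ j) *_) (A≗B zero j)) (det-cong (λ r c → A≗B (suc r) (punchIn j c)))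

  det-expand : ∀ {k} (A : Sq (suc k)) → det A ≡ sumFin (λ j → A zero j * cofactor A j)
  det-expand A = sum-cong λ j →
    solve 3 (λ s a d → (s :* a) :* d := a :* (s :* d)) refl (sgn (toℕ j)) (A zero j) (det (minor₀ A j))

  withRow₀ : ∀ {k} → (Fin (suc k) → Carrier) → Sq (suc k) → Sq (suc k)
  withRow₀ u A zero c = u c
  withRow₀ u A (suc r) c = A (suc r) c

  withRows₀₁ : ∀ {k} → (x y : Fin (suc (suc k)) → Carrier) → Sq (suc (suc k)) → Sq (suc (suc k))
  withRows₀₁ x y A zero c = x c
  withRows₀₁ x y A (suc zero) c = y c
  withRows₀₁ x y A (suc (suc r)) c = A (suc (suc r)) c

  minor₀₁ : ∀ {k} → Sq (suc (suc k)) → Fin (suc (suc k)) → Fin (suc k) → Carrier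
  minor₀₁ A j l = det (λ r c → A (suc (suc r)) (punchIn j (punchIn l c)))

  -- Laplace expansion along the first two rows, with those rows replaced by x and y.
  expand₀₁ : ∀ {k} → Sq (suc (suc k)) → (x y : Fin (suc (suc k)) → Carrier) → Carrier
  expand₀₁ A x y = sumFin λ j → sumFin λ l →
    (sgn (toℕ j) * x j) * (sgn (toℕ l) * y (punchIn j l) * minor₀₁ A j l)

  det-withRows₀₁ : ∀ {k} (A : Sq (suc (suc k))) x y → det (withRows₀₁ x y A) ≡ expand₀₁ A x y
  det-withRows₀₁ A x y = sum-cong λ j →
    sym (sum-*ˡ (sgn (toℕ j) * x j) (λ l → sgn (toℕ l) * y (punchIn j l) * minor₀₁ A j l))

  det≡expand₀₁ : ∀ {k} (A : Sq (suc (suc k))) → det A ≡ expand₀₁ A (A zero) (A (suc zero))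
  det≡expand₀₁ A = det-withRows₀₁ A (A zero) (A (suc zero))

  punchIn-punchOut-comm : ∀ {k} {j j′ : Fin (suc (suc k))} (j≢j′ : j ≢ j′) (j′≢j : j′ ≢ j) (c : Fin k) →
    punchIn j (punchIn (punchOut j≢j′) c) ≡ punchIn j′ (punchIn (punchOut j′≢j) c)
  punchIn-punchOut-comm {k} {zero} {zero} j≢j′ _ c = ⊥-elim (j≢j′ refl)
  punchIn-punchOut-comm {k} {zero} {suc j′} _ _ c = refl
  punchIn-punchOut-comm {k} {suc j} {zero} _ _ c = refl
  punchIn-punchOut-comm {zero} {suc zero} {suc zero} _ _ ()
  punchIn-punchOut-comm {suc k} {suc j} {suc j′} _ _ zero = refl
  punchIn-punchOut-comm {suc k} {suc j} {suc j′} j≢j′ j′≢j (suc c) =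
    cong suc (punchIn-punchOut-comm (j≢j′ ∘ cong suc) (j′≢j ∘ cong suc) c)

  sgn-punchOut-anticomm : ∀ {k} {j j′ : Fin (suc (suc k))} (j≢j′ : j ≢ j′) (j′≢j : j′ ≢ j) →
    sgn (toℕ j) * sgn (toℕ (punchOut j≢j′)) ≡ - (sgn (toℕ j′) * sgn (toℕ (punchOut j′≢j)))
  sgn-punchOut-anticomm {k} {zero} {zero} j≢j′ _ = ⊥-elim (j≢j′ refl)
  sgn-punchOut-anticomm {k} {zero} {suc j′} _ _ =
    solve 2 (λ o s → o :* s := :- ((:- s) :* o)) refl 1# (sgn (toℕ j′))
  sgn-punchOut-anticomm {k} {suc j} {zero} _ _ =
    solve 2 (λ o s → (:- s) :* o := :- (o :* s)) refl 1# (sgn (toℕ j))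
  sgn-punchOut-anticomm {zero} {suc zero} {suc zero} j≢j′ _ = ⊥-elim (j≢j′ refl)
  sgn-punchOut-anticomm {suc k} {suc j} {suc j′} j≢j′ j′≢j =
    trans (solve 2 (λ a b → (:- a) :* (:- b) := a :* b) refl (sgn (toℕ j)) _)
      (trans (sgn-punchOut-anticomm (j≢j′ ∘ cong suc) (j′≢j ∘ cong suc))
             (cong -_ (solve 2 (λ a b → a :* b := (:- a) :* (:- b)) refl (sgn (toℕ j′)) _)))

  -- Group the terms of expand₀₁ A a a by the unordered pair of columns {j, j′} that rows 0 and 1
  -- occupy: the two orderings of a pair cancel, since the complementary minor is the same and
  -- the signs differ.
  module ExpandDiagonal {k} (A : Sq (suc (suc k))) (a : Fin (suc (suc k)) → Carrier) where
    term : Fin (suc (suc k)) → Fin (suc (suc k)) → Carrier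
    term j j′ with j Fin.≟ j′
    ... | yes _ = 0#
    ... | no j≢j′ = (sgn (toℕ j) * sgn (toℕ (punchOut j≢j′))) * (a j * a j′)
                    * det (λ r c → A (suc (suc r)) (punchIn j (punchIn (punchOut j≢j′) c)))

    term-diag : ∀ j → term j j ≡ 0#
    term-diag j with j Fin.≟ j
    ... | yes _ = refl
    ... | no j≢j = ⊥-elim (j≢j refl)

    term-punchIn : ∀ j l → term j (punchIn j l) ≡ (sgn (toℕ j) * a j) * (sgn (toℕ l) * a (punchIn j l) * minor₀₁ A j l)
    term-punchIn j l with j Fin.≟ punchIn j l
    ... | yes j≡ = ⊥-elim (Fin.punchInᵢ≢i j l (sym j≡))
    ... | no j≢ = trans
      (cong (λ x → (sgn (toℕ j) * sgn (toℕ x)) * (a j * a (punchIn j l)) * det (λ r c → A (suc (suc r)) (punchIn j (punchIn x c))))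
            (trans (Fin.punchOut-cong j {i≢j = j≢} {i≢k = Fin.punchInᵢ≢i j l ∘ sym} refl) (Fin.punchOut-punchIn j)))
      (solve 5 (λ s t x y d → (s :* t) :* (x :* y) :* d := (s :* x) :* (t :* y :* d)) refl
             (sgn (toℕ j)) (sgn (toℕ l)) (a j) (a (punchIn j l)) (minor₀₁ A j l))

    term-antisym : ∀ j j′ → term j′ j ≡ - term j j′
    term-antisym j j′ with j Fin.≟ j′ | j′ Fin.≟ j
    ... | yes _ | yes _ = sym -0#≈0#
    ... | yes j≡j′ | no j′≢j = ⊥-elim (j′≢j (sym j≡j′))
    ... | no j≢j′ | yes j′≡j = ⊥-elim (j≢j′ (sym j′≡j))
    ... | no j≢j′ | no j′≢j = begin
      s′ * (a j′ * a j) * E′ ≡⟨ cong₂ (λ u v → u * (a j′ * a j) * v) (sgn-punchOut-anticomm j′≢j j≢j′)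
                                       (det-cong (λ r c → cong (A (suc (suc r))) (punchIn-punchOut-comm j′≢j j≢j′ c))) ⟩
      (- s) * (a j′ * a j) * E  ≡⟨ solve 4 (λ u x y d → (:- u) :* (y :* x) :* d := :- (u :* (x :* y) :* d)) refl s (a j) (a j′) E ⟩
      - (s * (a j * a j′) * E) ∎
      where
        open ≡-Reasoning
        s = sgn (toℕ j) * sgn (toℕ (punchOut j≢j′))
        s′ = sgn (toℕ j′) * sgn (toℕ (punchOut j′≢j))
        E = det (λ r c → A (suc (suc r)) (punchIn j (punchIn (punchOut j≢j′) c)))
        E′ = det (λ r c → A (suc (suc r)) (punchIn j′ (punchIn (punchOut j′≢j) c)))

    sum-term≡0 : sumFin (λ j → sumFin (term j)) ≡ 0#
    sum-term≡0 = x≡-x⇒x≡0 (begin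
      sumFin (λ j → sumFin (term j))            ≡⟨ sum-comm term ⟩
      sumFin (λ j′ → sumFin (λ j → term j j′))  ≡⟨ sum-cong (λ j′ → sum-cong (λ j → term-antisym j′ j)) ⟩
      sumFin (λ j′ → sumFin (λ j → - term j′ j)) ≡⟨ sum-cong (λ j′ → sum-neg (term j′)) ⟩
      sumFin (λ j′ → - sumFin (term j′))        ≡⟨ sum-neg (λ j′ → sumFin (term j′)) ⟩
      - sumFin (λ j → sumFin (term j))          ∎)
      where open ≡-Reasoning

    expand₀₁-diag : expand₀₁ A a a ≡ 0#
    expand₀₁-diag = trans (sum-cong λ j → begin
      sumFin (λ l → (sgn (toℕ j) * a j) * (sgn (toℕ l) * a (punchIn j l) * minor₀₁ A j l))
                                                    ≡⟨ sym (sum-cong (term-punchIn j)) ⟩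
      sumFin (λ l → term j (punchIn j l))           ≡⟨ sym (+-identityˡ _) ⟩
      0# + sumFin (λ l → term j (punchIn j l))      ≡⟨ cong (_+ sumFin (λ l → term j (punchIn j l))) (sym (term-diag j)) ⟩
      term j j + sumFin (λ l → term j (punchIn j l)) ≡⟨ sym (sum-remove (term j) j) ⟩
      sumFin (term j)                               ∎) sum-term≡0
      where open ≡-Reasoning

  open ExpandDiagonal using (expand₀₁-diag)

  expand₀₁-+ : ∀ {k} (A : Sq (suc (suc k))) x y →
    expand₀₁ A (λ c → x c + y c) (λ c → x c + y c) ≡ (expand₀₁ A x x + expand₀₁ A x y) + (expand₀₁ A y x + expand₀₁ A y y)
  expand₀₁-+ A x y = trans (sum-cong λ j → trans (sum-cong λ l → expandTerm j l) (sum-+₄ (T x x j) (T x y j) (T y x j) (T y y j)))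
                           (sum-+₄ (λ j → sumFin (T x x j)) (λ j → sumFin (T x y j)) (λ j → sumFin (T y x j)) (λ j → sumFin (T y y j)))
    where
      T : (u v : _) → _ → _ → Carrier
      T u v j l = (sgn (toℕ j) * u j) * (sgn (toℕ l) * v (punchIn j l) * minor₀₁ A j l)

      sum-+₄ : ∀ {n} (f g h e : Fin n → Carrier) →
        sumFin (λ i → (f i + g i) + (h i + e i)) ≡ (sumFin f + sumFin g) + (sumFin h + sumFin e)
      sum-+₄ f g h e = trans (sum-+ (λ i → f i + g i) (λ i → h i + e i)) (cong₂ _+_ (sum-+ f g) (sum-+ h e))

      expandTerm : ∀ j l → T (λ c → x c + y c) (λ c → x c + y c) j l ≡ (T x x j l + T x y j l) + (T y x j l + T y y j l)
      expandTerm j l = solve 7 (λ s x y t x′ y′ d →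
          (s :* (x :+ y)) :* (t :* (x′ :+ y′) :* d)
            := ((s :* x) :* (t :* x′ :* d) :+ (s :* x) :* (t :* y′ :* d))
               :+ ((s :* y) :* (t :* x′ :* d) :+ (s :* y) :* (t :* y′ :* d)))
        refl (sgn (toℕ j)) (x j) (y j) (sgn (toℕ l)) (x (punchIn j l)) (y (punchIn j l)) (minor₀₁ A j l)

  expand₀₁-antisym : ∀ {k} (A : Sq (suc (suc k))) x y → expand₀₁ A y x ≡ - expand₀₁ A x y
  expand₀₁-antisym A x y = x+y≡0⇒x≡-y (begin
    β y x + β x y                           ≡⟨ +-comm _ _ ⟩
    β x y + β y x                           ≡⟨ sym (cong₂ _+_ (+-identityˡ _) (+-identityʳ _)) ⟩
    (0# + β x y) + (β y x + 0#)             ≡⟨ sym (cong₂ (λ u v → (u + β x y) + (β y x + v)) (expand₀₁-diag A x) (expand₀₁-diag A y)) ⟩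
    (β x x + β x y) + (β y x + β y y)       ≡⟨ sym (expand₀₁-+ A x y) ⟩
    β (λ c → x c + y c) (λ c → x c + y c)   ≡⟨ expand₀₁-diag A (λ c → x c + y c) ⟩
    0#                                      ∎)
    where
      open ≡-Reasoning
      β = expand₀₁ A

  det-swap₀₁ : ∀ {k} (A : Sq (suc (suc k))) → det (withRows₀₁ (A (suc zero)) (A zero) A) ≡ - det A
  det-swap₀₁ A = begin
    det (withRows₀₁ (A (suc zero)) (A zero) A) ≡⟨ det-withRows₀₁ A (A (suc zero)) (A zero) ⟩
    expand₀₁ A (A (suc zero)) (A zero)         ≡⟨ expand₀₁-antisym A (A zero) (A (suc zero)) ⟩
    - expand₀₁ A (A zero) (A (suc zero))       ≡⟨ cong -_ (sym (det≡expand₀₁ A)) ⟩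
    - det A                                    ∎
    where open ≡-Reasoning

  mutual
    det-equalRows : ∀ {k} (A : Sq k) (p q : Fin k) → p ≢ q → (∀ c → A p c ≡ A q c) → det A ≡ 0#
    det-equalRows A zero zero p≢q _ = ⊥-elim (p≢q refl)
    det-equalRows A zero (suc q) _ A₀≡A₁₊q = det-equalRows₀ A q A₀≡A₁₊q
    det-equalRows A (suc p) zero _ A₁₊p≡A₀ = det-equalRows₀ A p (sym ∘ A₁₊p≡A₀)
    det-equalRows A (suc p) (suc q) p≢q A₁₊p≡A₁₊q = det-equalRows₊ A p q (p≢q ∘ cong suc) A₁₊p≡A₁₊q

    det-equalRows₊ : ∀ {k} (A : Sq (suc k)) (p q : Fin k) → p ≢ q → (∀ c → A (suc p) c ≡ A (suc q) c) → det A ≡ 0#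
    det-equalRows₊ A p q p≢q A₁₊p≡A₁₊q = sum-zeros λ j →
      trans (cong (sgn (toℕ j) * A zero j *_) (det-equalRows (minor₀ A j) p q p≢q (A₁₊p≡A₁₊q ∘ punchIn j))) (zeroʳ _)

    det-equalRows₀ : ∀ {k} (A : Sq (suc k)) (q : Fin k) → (∀ c → A zero c ≡ A (suc q) c) → det A ≡ 0#
    det-equalRows₀ {suc k} A zero A₀≡A₁ = begin
      det A                                   ≡⟨ det-cong {B = withRows₀₁ (A zero) (A zero) A} rows ⟩
      det (withRows₀₁ (A zero) (A zero) A)    ≡⟨ det-withRows₀₁ A (A zero) (A zero) ⟩
      expand₀₁ A (A zero) (A zero)            ≡⟨ expand₀₁-diag A (A zero) ⟩
      0#                                      ∎
      where
        open ≡-Reasoning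
        rows : ∀ r c → A r c ≡ withRows₀₁ (A zero) (A zero) A r c
        rows zero c = refl
        rows (suc zero) c = sym (A₀≡A₁ c)
        rows (suc (suc r)) c = refl
    det-equalRows₀ {suc k} A (suc q) A₀≡A₂₊q = begin
      det A                      ≡⟨ sym (-‿involutive _) ⟩
      - - det A                  ≡⟨ cong -_ (sym (det-swap₀₁ A)) ⟩
      - det A′                   ≡⟨ cong -_ (det-equalRows₊ A′ zero (suc q) (λ ()) A₀≡A₂₊q) ⟩
      - 0#                       ≡⟨ -0#≈0# ⟩
      0#                         ∎
      where
        open ≡-Reasoning
        A′ = withRows₀₁ (A (suc zero)) (A zero) A

  row-cofactor≡0 : ∀ {k} (A : Sq (suc k)) (t : Fin k) → sumFin (λ j → A (suc t) j * cofactor A j) ≡ 0#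
  row-cofactor≡0 A t = trans (sym (det-expand (withRow₀ (A (suc t)) A)))
                             (det-equalRows₀ (withRow₀ (A (suc t)) A) t (λ c → refl))

  ≡-or-punchIn : ∀ {k} (j c : Fin (suc k)) → c ≡ j ⊎ ∃ λ c′ → c ≡ punchIn j c′
  ≡-or-punchIn j c with j Fin.≟ c
  ... | yes j≡c = inj₁ (sym j≡c)
  ... | no j≢c = inj₂ (punchOut j≢c , sym (Fin.punchIn-punchOut j≢c))

  δ-punchIn : ∀ {k} (j : Fin (suc k)) a b → δ (punchIn j a) (punchIn j b) ≡ δ a b
  δ-punchIn j a b with a Fin.≟ b
  ... | yes refl = δ-refl (punchIn j a)
  ... | no a≢b = δ-≢ (a≢b ∘ Fin.punchIn-injective j a b)

  δ-punchInʳ : ∀ {k} (j : Fin (suc k)) b → δ j (punchIn j b) ≡ 0#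
  δ-punchInʳ j b = δ-≢ (Fin.punchInᵢ≢i j b ∘ sym)

  δ-punchInˡ : ∀ {k} (j : Fin (suc k)) b → δ (punchIn j b) j ≡ 0#
  δ-punchInˡ j b = δ-≢ (Fin.punchInᵢ≢i j b)

  LeftInverse : ∀ {k} → Sq k → Set
  LeftInverse {k} B = Σ (Sq k) λ C → ∀ r c → sumFin (λ t → C r t * B t c) ≡ δ r c

  -- Inverting B from a left inverse C′ of its minor at column j: first clear row 0 of B away from
  -- column j using the rows below it, then rescale.  The pivot left in column j is nonzero because
  -- its product with the cofactor is det B.
  module LeftInverseStep {k} (B : Sq (suc k)) (j : Fin (suc k)) (det≢0 : det B ≢ 0#)
                         (C′ : Sq k) (C′-inv : ∀ r c → sumFin (λ t → C′ r t * minor₀ B j t c) ≡ δ r c) where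
    μ : Fin k → Carrier
    μ t = sumFin (λ c → B zero (punchIn j c) * C′ c t)

    clearing : Fin (suc k) → Carrier
    clearing zero = 1#
    clearing (suc t) = - μ t

    cleared : Fin (suc k) → Carrier
    cleared c = sumFin (λ t → clearing t * B t c)

    μ-solves : ∀ c → sumFin (λ t → μ t * B (suc t) (punchIn j c)) ≡ B zero (punchIn j c)
    μ-solves c = begin
      sumFin (λ t → μ t * B (suc t) (punchIn j c))
        ≡⟨ sum-cong (λ t → sym (sum-*ʳ _ (λ c′ → b c′ * C′ c′ t))) ⟩
      sumFin (λ t → sumFin (λ c′ → b c′ * C′ c′ t * B (suc t) (punchIn j c)))
        ≡⟨ sum-comm (λ t c′ → b c′ * C′ c′ t * B (suc t) (punchIn j c)) ⟩
      sumFin (λ c′ → sumFin (λ t → b c′ * C′ c′ t * B (suc t) (punchIn j c)))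
        ≡⟨ sum-cong (λ c′ → sum-*ˡ-assoc (b c′) (C′ c′) (λ t → B (suc t) (punchIn j c))) ⟩
      sumFin (λ c′ → b c′ * sumFin (λ t → C′ c′ t * B (suc t) (punchIn j c)))
        ≡⟨ sum-cong (λ c′ → cong (b c′ *_) (C′-inv c′ c)) ⟩
      sumFin (λ c′ → b c′ * δ c′ c)
        ≡⟨ sum-δʳ b c ⟩
      b c ∎
      where
        open ≡-Reasoning
        b = λ c → B zero (punchIn j c)

    cleared-punchIn : ∀ c → cleared (punchIn j c) ≡ 0#
    cleared-punchIn c = begin
      1# * B zero (punchIn j c) + sumFin (λ t → - μ t * B (suc t) (punchIn j c))
        ≡⟨ cong₂ _+_ (*-identityˡ _) (sum-cong (λ t → sym (-‿distribˡ-* (μ t) _))) ⟩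
      B zero (punchIn j c) + sumFin (λ t → - (μ t * B (suc t) (punchIn j c)))
        ≡⟨ cong (B zero (punchIn j c) +_) (trans (sum-neg (λ t → μ t * B (suc t) (punchIn j c))) (cong -_ (μ-solves c))) ⟩
      B zero (punchIn j c) - B zero (punchIn j c)
        ≡⟨ -‿inverseʳ _ ⟩
      0# ∎
      where open ≡-Reasoning

    cleared-cofactors : sumFin (λ c → cleared c * cofactor B c) ≡ det B
    cleared-cofactors = begin
      sumFin (λ c → cleared c * cofactor B c)
        ≡⟨ sum-cong (λ c → sym (sum-*ʳ (cofactor B c) (λ t → clearing t * B t c))) ⟩
      sumFin (λ c → sumFin (λ t → clearing t * B t c * cofactor B c))
        ≡⟨ sum-comm (λ c t → clearing t * B t c * cofactor B c) ⟩
      sumFin (λ t → sumFin (λ c → clearing t * B t c * cofactor B c))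
        ≡⟨ sum-cong (λ t → sum-*ˡ-assoc (clearing t) (B t) (cofactor B)) ⟩
      sumFin (λ t → clearing t * sumFin (λ c → B t c * cofactor B c))
        ≡⟨ cong₂ _+_ (trans (*-identityˡ _) (sym (det-expand B)))
                     (sum-zeros (λ t → trans (cong (clearing (suc t) *_) (row-cofactor≡0 B t)) (zeroʳ _))) ⟩
      det B + 0#
        ≡⟨ +-identityʳ _ ⟩
      det B ∎
      where open ≡-Reasoning

    pivot≢0 : cleared j ≢ 0#
    pivot≢0 pivot≡0 = det≢0 (begin
      det B                                    ≡⟨ sym cleared-cofactors ⟩
      sumFin (λ c → cleared c * cofactor B c)  ≡⟨ sum-supported-at _ j off-pivot ⟩
      cleared j * cofactor B j                 ≡⟨ cong (_* cofactor B j) pivot≡0 ⟩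
      0# * cofactor B j                        ≡⟨ zeroˡ _ ⟩
      0#                                       ∎)
      where
        open ≡-Reasoning
        off-pivot : ∀ c → c ≢ j → cleared c * cofactor B c ≡ 0#
        off-pivot c c≢j with ≡-or-punchIn j c
        ... | inj₁ c≡j = ⊥-elim (c≢j c≡j)
        ... | inj₂ (c′ , refl) = trans (cong (_* cofactor B (punchIn j c′)) (cleared-punchIn c′)) (zeroˡ _)

    pivotRow : Fin (suc k) → Carrier
    pivotRow t = inv (cleared j) pivot≢0 * clearing t

    pivotRow-inv : ∀ c → sumFin (λ t → pivotRow t * B t c) ≡ δ j c
    pivotRow-inv c = trans (sum-*ˡ-assoc (inv (cleared j) pivot≢0) clearing (λ t → B t c)) (at (≡-or-punchIn j c))
      where
        at : c ≡ j ⊎ ∃ (λ c′ → c ≡ punchIn j c′) → inv (cleared j) pivot≢0 * cleared c ≡ δ j c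
        at (inj₁ refl) = trans (inv-l _ pivot≢0) (sym (δ-refl j))
        at (inj₂ (c′ , refl)) = trans (cong (inv (cleared j) pivot≢0 *_) (cleared-punchIn c′)) (trans (zeroʳ _) (sym (δ-punchInʳ j c′)))

    lift : Fin k → Fin (suc k) → Carrier
    lift r zero = 0#
    lift r (suc t) = C′ r t

    liftAtPivot : Fin k → Carrier
    liftAtPivot r = sumFin (λ t → C′ r t * B (suc t) j)

    otherRow : Fin k → Fin (suc k) → Carrier
    otherRow r t = lift r t - liftAtPivot r * pivotRow t

    otherRow-inv : ∀ r c → sumFin (λ t → otherRow r t * B t c) ≡ δ (punchIn j r) c
    otherRow-inv r c = trans expand (at (≡-or-punchIn j c))
      where
        expand : sumFin (λ t → otherRow r t * B t c)
                   ≡ (0# * B zero c + sumFin (λ t → C′ r t * B (suc t) c)) - liftAtPivot r * δ j c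
        expand = begin
          sumFin (λ t → otherRow r t * B t c)
            ≡⟨ sum-cong (λ t → solve 4 (λ l v p b → (l :- v :* p) :* b := l :* b :- v :* (p :* b)) refl
                                       (lift r t) (liftAtPivot r) (pivotRow t) (B t c)) ⟩
          sumFin (λ t → lift r t * B t c - liftAtPivot r * (pivotRow t * B t c))
            ≡⟨ sum-difference (λ t → lift r t * B t c) (λ t → liftAtPivot r * (pivotRow t * B t c)) ⟩
          sumFin (λ t → lift r t * B t c) - sumFin (λ t → liftAtPivot r * (pivotRow t * B t c))
            ≡⟨ cong (λ z → sumFin (λ t → lift r t * B t c) - z)
                    (trans (sum-*ˡ (liftAtPivot r) (λ t → pivotRow t * B t c)) (cong (liftAtPivot r *_) (pivotRow-inv c))) ⟩
          (0# * B zero c + sumFin (λ t → C′ r t * B (suc t) c)) - liftAtPivot r * δ j c ∎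
          where open ≡-Reasoning
        at : c ≡ j ⊎ ∃ (λ c′ → c ≡ punchIn j c′) →
             (0# * B zero c + sumFin (λ t → C′ r t * B (suc t) c)) - liftAtPivot r * δ j c ≡ δ (punchIn j r) c
        at (inj₁ refl) = begin
          (0# * B zero j + liftAtPivot r) - liftAtPivot r * δ j j ≡⟨ cong₂ (λ a b → (a + liftAtPivot r) - liftAtPivot r * b) (zeroˡ _) (δ-refl j) ⟩
          (0# + liftAtPivot r) - liftAtPivot r * 1#               ≡⟨ cong₂ _-_ (+-identityˡ _) (*-identityʳ _) ⟩
          liftAtPivot r - liftAtPivot r                            ≡⟨ -‿inverseʳ _ ⟩
          0#                                                      ≡⟨ sym (δ-punchInˡ j r) ⟩
          δ (punchIn j r) j                                       ∎
          where open ≡-Reasoning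
        at (inj₂ (c′ , refl)) = begin
          (0# * _ + sumFin (λ t → C′ r t * B (suc t) (punchIn j c′))) - liftAtPivot r * δ j (punchIn j c′)
            ≡⟨ cong₂ (λ a b → a - liftAtPivot r * b) (cong₂ _+_ (zeroˡ _) (C′-inv r c′)) (δ-punchInʳ j c′) ⟩
          (0# + δ r c′) - liftAtPivot r * 0#
            ≡⟨ cong₂ _-_ (+-identityˡ _) (zeroʳ _) ⟩
          δ r c′ - 0#
            ≡⟨ trans (cong (δ r c′ +_) -0#≈0#) (+-identityʳ _) ⟩
          δ r c′
            ≡⟨ sym (δ-punchIn j r c′) ⟩
          δ (punchIn j r) (punchIn j c′) ∎
          where open ≡-Reasoning

    inverse : LeftInverse B
    inverse = C , C-inv
      where
        C : Sq (suc k)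
        C r with j Fin.≟ r
        ... | yes _ = pivotRow
        ... | no j≢r = otherRow (punchOut j≢r)

        C-inv : ∀ r c → sumFin (λ t → C r t * B t c) ≡ δ r c
        C-inv r c with j Fin.≟ r
        ... | yes refl = pivotRow-inv c
        ... | no j≢r = trans (otherRow-inv (punchOut j≢r) c) (cong (λ r′ → δ r′ c) (Fin.punchIn-punchOut j≢r))

  det≢0⇒leftInverse : ∀ {k} (B : Sq k) → det B ≢ 0# → LeftInverse B
  det≢0⇒leftInverse {zero} B _ = B , λ ()
  det≢0⇒leftInverse {suc k} B det≢0
    with sum≢0⇒∃≢0 (λ j → B zero j * cofactor B j) (det≢0 ∘ trans (det-expand B))
  ... | j , term≢0 with det≢0⇒leftInverse (minor₀ B j) (x*y≢0⇒y≢0 (x*y≢0⇒y≢0 term≢0))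
  ... | C′ , C′-inv = LeftInverseStep.inverse B j det≢0 C′ C′-inv

module SkewForm (ℝ : RealField) where
  open Determinant ℝ public

  Vec2 : ℕ → Set
  Vec2 m = Col (suc m) → Carrier

  -- Ω x y = ω x y - ω y x, where ω x y = Σᵢ xᵢ (ℓ y)ᵢ = Σᵢ y_ĩ (ϰ x)ᵢ: the form pairs xᵢ with
  -- y_ĩ and y_{(i-1)~}, the wrap-around term carrying the sign (-1)ⁿ.
  ℓ : ∀ {m} → Vec2 m → Fin (suc m) → Carrier
  ℓ {m} y zero = y (zero , true) + sgn (suc m) * y (fromℕ m , true)
  ℓ {m} y (suc j) = y (suc j , true) + y (inject₁ j , true)

  ω : ∀ {m} → Vec2 m → Vec2 m → Carrier
  ω x y = sumFin (λ i → x (i , false) * ℓ y i)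

  ϰ : ∀ {m} → Vec2 m → Fin (suc m) → Carrier
  ϰ {m} x i = x (i , false) + sumFin (λ (j : Fin m) → δ (inject₁ j) i * x (suc j , false))
              + δ (fromℕ m) i * (sgn (suc m) * x (zero , false))

  ω-expanded : ∀ {m} (x y : Vec2 m) → ω x y ≡
    (sumFin (λ i → x (i , false) * y (i , true)) + sumFin (λ (j : Fin m) → x (suc j , false) * y (inject₁ j , true)))
    + sgn (suc m) * (x (zero , false) * y (fromℕ m , true))
  ω-expanded {m} x y = begin
    x₀ * (y₀ + s * yₙ) + sumFin (λ j → x (suc j , false) * (y (suc j , true) + y (inject₁ j , true)))
      ≡⟨ cong (x₀ * (y₀ + s * yₙ) +_) (trans (sum-cong {m} (λ j → distribˡ _ _ _))
                                            (sum-+ (λ j → x (suc j , false) * y (suc j , true)) (λ j → x (suc j , false) * y (inject₁ j , true)))) ⟩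
    x₀ * (y₀ + s * yₙ) + (sumFin (λ j → x (suc j , false) * y (suc j , true)) + sumFin (λ j → x (suc j , false) * y (inject₁ j , true)))
      ≡⟨ solve 6 (λ x₀ y₀ s yₙ u v → x₀ :* (y₀ :+ s :* yₙ) :+ (u :+ v) := ((x₀ :* y₀ :+ u) :+ v) :+ s :* (x₀ :* yₙ)) refl x₀ y₀ s yₙ _ _ ⟩
    _ ∎
    where
      open ≡-Reasoning
      s = sgn (suc m)
      x₀ = x (zero , false)
      y₀ = y (zero , true)
      yₙ = y (fromℕ m , true)

  Ω≡ω-ω : ∀ {m} (x y : Vec2 m) → Ω x y ≡ ω x y - ω y x
  Ω≡ω-ω {m} x y = begin
    Ω x y
      ≡⟨ cong₂ (λ a b → (a + b) + s * (x₀ * yₙ - xₙ * y₀))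
               (sum-difference (λ i → x (i , false) * y (i , true)) (λ i → x (i , true) * y (i , false)))
               (sum-difference (λ j → x (suc j , false) * y (inject₁ j , true)) (λ j → x (inject₁ j , true) * y (suc j , false))) ⟩
    ((p₁ - q₁) + (p₂ - q₂)) + s * (x₀ * yₙ - xₙ * y₀)
      ≡⟨ solve 9 (λ p₁ q₁ p₂ q₂ s a b c d → ((p₁ :- q₁) :+ (p₂ :- q₂)) :+ s :* (a :* b :- c :* d)
                                            := ((p₁ :+ p₂) :+ s :* (a :* b)) :- ((q₁ :+ q₂) :+ s :* (d :* c)))
                 refl p₁ q₁ p₂ q₂ s x₀ yₙ xₙ y₀ ⟩
    ((p₁ + p₂) + s * (x₀ * yₙ)) - ((q₁ + q₂) + s * (y₀ * xₙ))
      ≡⟨ cong₂ (λ a b → ((p₁ + p₂) + s * (x₀ * yₙ)) - ((a + b) + s * (y₀ * xₙ)))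
               (sum-cong {suc m} (λ i → *-comm (x (i , true)) (y (i , false))))
               (sum-cong {m} (λ j → *-comm (x (inject₁ j , true)) (y (suc j , false)))) ⟩
    ((p₁ + p₂) + s * (x₀ * yₙ))
      - ((sumFin (λ i → y (i , false) * x (i , true)) + sumFin (λ (j : Fin m) → y (suc j , false) * x (inject₁ j , true))) + s * (y₀ * xₙ))
      ≡⟨ sym (cong₂ _-_ (ω-expanded x y) (ω-expanded y x)) ⟩
    ω x y - ω y x ∎
    where
      open ≡-Reasoning
      s = sgn (suc m)
      x₀ = x (zero , false)
      y₀ = y (zero , false)
      xₙ = x (fromℕ m , true)
      yₙ = y (fromℕ m , true)
      p₁ = sumFin (λ i → x (i , false) * y (i , true))
      q₁ = sumFin (λ i → x (i , true) * y (i , false))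
      p₂ = sumFin (λ (j : Fin m) → x (suc j , false) * y (inject₁ j , true))
      q₂ = sumFin (λ (j : Fin m) → x (inject₁ j , true) * y (suc j , false))

  ω≡Σϰ : ∀ {m} (x y : Vec2 m) → ω x y ≡ sumFin (λ i → y (i , true) * ϰ x i)
  ω≡Σϰ {m} x y = sym (begin
    sumFin (λ i → y (i , true) * ϰ x i)
      ≡⟨ sum-cong {suc m} distribute ⟩
    sumFin (λ i → (x (i , false) * y (i , true) + sumFin (λ j → δ (inject₁ j) i * (x (suc j , false) * y (i , true))))
                  + δ (fromℕ m) i * (s * (x₀ * y (i , true))))
      ≡⟨ trans (sum-+ (λ i → x (i , false) * y (i , true) + sumFin (λ j → δ (inject₁ j) i * (x (suc j , false) * y (i , true))))
                      (λ i → δ (fromℕ m) i * (s * (x₀ * y (i , true)))))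
               (cong₂ _+_ (sum-+ (λ i → x (i , false) * y (i , true)) (λ i → sumFin (λ j → δ (inject₁ j) i * (x (suc j , false) * y (i , true)))))
                          (sum-δˡ (λ i → s * (x₀ * y (i , true))) (fromℕ m))) ⟩
    (sumFin (λ i → x (i , false) * y (i , true)) + sumFin (λ i → sumFin (λ j → δ (inject₁ j) i * (x (suc j , false) * y (i , true)))))
      + s * (x₀ * y (fromℕ m , true))
      ≡⟨ cong (λ z → (sumFin (λ i → x (i , false) * y (i , true)) + z) + s * (x₀ * y (fromℕ m , true)))
              (trans (sum-comm (λ i j → δ (inject₁ j) i * (x (suc j , false) * y (i , true))))
                     (sum-cong {m} (λ j → sum-δˡ (λ i → x (suc j , false) * y (i , true)) (inject₁ j)))) ⟩
    (sumFin (λ i → x (i , false) * y (i , true)) + sumFin (λ j → x (suc j , false) * y (inject₁ j , true)))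
      + s * (x₀ * y (fromℕ m , true))
      ≡⟨ sym (ω-expanded x y) ⟩
    ω x y ∎)
    where
      open ≡-Reasoning
      s = sgn (suc m)
      x₀ = x (zero , false)
      distribute : ∀ i → y (i , true) * ϰ x i ≡
        (x (i , false) * y (i , true) + sumFin (λ j → δ (inject₁ j) i * (x (suc j , false) * y (i , true))))
        + δ (fromℕ m) i * (s * (x₀ * y (i , true)))
      distribute i = begin
        y (i , true) * (x (i , false) + Σδx + δ (fromℕ m) i * (s * x₀))
          ≡⟨ solve 6 (λ y a b d s x₀ → y :* (a :+ b :+ d :* (s :* x₀)) := (a :* y :+ y :* b) :+ d :* (s :* (x₀ :* y)))
                   refl (y (i , true)) (x (i , false)) Σδx (δ (fromℕ m) i) s x₀ ⟩
        (x (i , false) * y (i , true) + y (i , true) * Σδx) + δ (fromℕ m) i * (s * (x₀ * y (i , true)))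
          ≡⟨ cong (λ z → (x (i , false) * y (i , true) + z) + δ (fromℕ m) i * (s * (x₀ * y (i , true))))
                  (trans (sym (sum-*ˡ (y (i , true)) (λ j → δ (inject₁ j) i * x (suc j , false))))
                         (sum-cong {m} (λ j → solve 3 (λ y d x → y :* (d :* x) := d :* (x :* y)) refl
                                                      (y (i , true)) (δ (inject₁ j) i) (x (suc j , false))))) ⟩
        _ ∎
        where Σδx = sumFin (λ (j : Fin m) → δ (inject₁ j) i * x (suc j , false))

  lincomb : ∀ {K m} → (Fin K → Carrier) → (Fin K → Vec2 m) → Vec2 m
  lincomb g a c = sumFin (λ k → g k * a k c)

  ℓ-lincomb : ∀ {K m} (g : Fin K → Carrier) (a : Fin K → Vec2 m) i → ℓ (lincomb g a) i ≡ sumFin (λ k → g k * ℓ (a k) i)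
  ℓ-lincomb {K} {m} g a zero = begin
    sumFin (λ k → g k * a k (zero , true)) + s * sumFin (λ k → g k * a k (fromℕ m , true))
      ≡⟨ cong (sumFin (λ k → g k * a k (zero , true)) +_) (sym (sum-*ˡ s (λ k → g k * a k (fromℕ m , true)))) ⟩
    sumFin (λ k → g k * a k (zero , true)) + sumFin (λ k → s * (g k * a k (fromℕ m , true)))
      ≡⟨ sym (sum-+ (λ k → g k * a k (zero , true)) (λ k → s * (g k * a k (fromℕ m , true)))) ⟩
    sumFin (λ k → g k * a k (zero , true) + s * (g k * a k (fromℕ m , true)))
      ≡⟨ sum-cong {K} (λ k → solve 4 (λ g u s v → g :* u :+ s :* (g :* v) := g :* (u :+ s :* v)) refl
                                     (g k) (a k (zero , true)) s (a k (fromℕ m , true))) ⟩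
    sumFin (λ k → g k * ℓ (a k) zero) ∎
    where
      open ≡-Reasoning
      s = sgn (suc m)
  ℓ-lincomb {K} g a (suc j) = trans (sym (sum-+ (λ k → g k * a k (suc j , true)) (λ k → g k * a k (inject₁ j , true))))
                                    (sum-cong {K} (λ k → sym (distribˡ (g k) _ _)))

  ω-lincombʳ : ∀ {K m} (x : Vec2 m) (g : Fin K → Carrier) (a : Fin K → Vec2 m) → ω x (lincomb g a) ≡ sumFin (λ k → g k * ω x (a k))
  ω-lincombʳ {K} {m} x g a = begin
    sumFin (λ i → x (i , false) * ℓ (lincomb g a) i)
      ≡⟨ sum-cong {suc m} (λ i → trans (cong (x (i , false) *_) (ℓ-lincomb g a i)) (sym (sum-*ˡ (x (i , false)) (λ k → g k * ℓ (a k) i)))) ⟩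
    sumFin (λ i → sumFin (λ k → x (i , false) * (g k * ℓ (a k) i)))
      ≡⟨ sum-comm (λ i k → x (i , false) * (g k * ℓ (a k) i)) ⟩
    sumFin (λ k → sumFin (λ i → x (i , false) * (g k * ℓ (a k) i)))
      ≡⟨ sum-cong {K} (λ k → trans (sum-cong {suc m} (λ i → solve 3 (λ x g l → x :* (g :* l) := g :* (x :* l)) refl
                                                                  (x (i , false)) (g k) (ℓ (a k) i)))
                                   (sum-*ˡ (g k) (λ i → x (i , false) * ℓ (a k) i))) ⟩
    sumFin (λ k → g k * ω x (a k)) ∎
    where open ≡-Reasoning

  ω-lincombˡ : ∀ {K m} (y : Vec2 m) (g : Fin K → Carrier) (a : Fin K → Vec2 m) → ω (lincomb g a) y ≡ sumFin (λ k → g k * ω (a k) y)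
  ω-lincombˡ {K} {m} y g a = begin
    sumFin (λ i → lincomb g a (i , false) * ℓ y i)
      ≡⟨ sum-cong {suc m} (λ i → sym (sum-*ʳ (ℓ y i) (λ k → g k * a k (i , false)))) ⟩
    sumFin (λ i → sumFin (λ k → g k * a k (i , false) * ℓ y i))
      ≡⟨ sum-comm (λ i k → g k * a k (i , false) * ℓ y i) ⟩
    sumFin (λ k → sumFin (λ i → g k * a k (i , false) * ℓ y i))
      ≡⟨ sum-cong {K} (λ k → sum-*ˡ-assoc (g k) (λ i → a k (i , false)) (ℓ y)) ⟩
    sumFin (λ k → g k * ω (a k) y) ∎
    where open ≡-Reasoning

  private
    sum-scaled-difference : ∀ {K} (g u v : Fin K → Carrier) → sumFin (λ k → g k * u k) - sumFin (λ k → g k * v k) ≡ sumFin (λ k → g k * (u k - v k))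
    sum-scaled-difference {K} g u v = trans (sym (sum-difference (λ k → g k * u k) (λ k → g k * v k)))
                              (sum-cong {K} (λ k → solve 3 (λ g u v → g :* u :- g :* v := g :* (u :- v)) refl (g k) (u k) (v k)))

  Ω-lincombʳ : ∀ {K m} (x : Vec2 m) (g : Fin K → Carrier) (a : Fin K → Vec2 m) → Ω x (lincomb g a) ≡ sumFin (λ k → g k * Ω x (a k))
  Ω-lincombʳ {K} x g a = begin
    Ω x (lincomb g a)                                         ≡⟨ Ω≡ω-ω x (lincomb g a) ⟩
    ω x (lincomb g a) - ω (lincomb g a) x                     ≡⟨ cong₂ _-_ (ω-lincombʳ x g a) (ω-lincombˡ x g a) ⟩
    sumFin (λ k → g k * ω x (a k)) - sumFin (λ k → g k * ω (a k) x) ≡⟨ sum-scaled-difference g (λ k → ω x (a k)) (λ k → ω (a k) x) ⟩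
    sumFin (λ k → g k * (ω x (a k) - ω (a k) x))             ≡⟨ sum-cong {K} (λ k → cong (g k *_) (sym (Ω≡ω-ω x (a k)))) ⟩
    sumFin (λ k → g k * Ω x (a k))                            ∎
    where open ≡-Reasoning

  Ω-lincombˡ : ∀ {K m} (y : Vec2 m) (g : Fin K → Carrier) (a : Fin K → Vec2 m) → Ω (lincomb g a) y ≡ sumFin (λ k → g k * Ω (a k) y)
  Ω-lincombˡ {K} y g a = begin
    Ω (lincomb g a) y                                         ≡⟨ Ω≡ω-ω (lincomb g a) y ⟩
    ω (lincomb g a) y - ω y (lincomb g a)                     ≡⟨ cong₂ _-_ (ω-lincombˡ y g a) (ω-lincombʳ y g a) ⟩
    sumFin (λ k → g k * ω (a k) y) - sumFin (λ k → g k * ω y (a k)) ≡⟨ sum-scaled-difference g (λ k → ω (a k) y) (λ k → ω y (a k)) ⟩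
    sumFin (λ k → g k * (ω (a k) y - ω y (a k)))             ≡⟨ sum-cong {K} (λ k → cong (g k *_) (sym (Ω≡ω-ω (a k) y))) ⟩
    sumFin (λ k → g k * Ω (a k) y)                            ∎
    where open ≡-Reasoning

  Ω-lincomb-isotropic : ∀ {K m} (a : Fin K → Vec2 m) → (∀ k l → Ω (a k) (a l) ≡ 0#) →
    ∀ g h → Ω (lincomb g a) (lincomb h a) ≡ 0#
  Ω-lincomb-isotropic {K} a iso g h = trans (Ω-lincombˡ (lincomb h a) g a) (sum-zeros {K} λ k →
    trans (cong (g k *_) (trans (Ω-lincombʳ (a k) h a) (sum-zeros {K} λ l → trans (cong (h l *_) (iso k l)) (zeroʳ _))))
          (zeroʳ _))

  Ω-antisym : ∀ {m} (x y : Vec2 m) → Ω x y ≡ - Ω y x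
  Ω-antisym x y = begin
    Ω x y             ≡⟨ Ω≡ω-ω x y ⟩
    ω x y - ω y x     ≡⟨ solve 2 (λ a b → a :- b := :- (b :- a)) refl (ω x y) (ω y x) ⟩
    - (ω y x - ω x y) ≡⟨ cong -_ (sym (Ω≡ω-ω y x)) ⟩
    - Ω y x           ∎
    where open ≡-Reasoning

  Ω-self : ∀ {m} (x : Vec2 m) → Ω x x ≡ 0#
  Ω-self x = trans (Ω≡ω-ω x x) (-‿inverseʳ _)

  Ω-cong : ∀ {m} {x x′ y y′ : Vec2 m} → (∀ c → x c ≡ x′ c) → (∀ c → y c ≡ y′ c) → Ω x y ≡ Ω x′ y′
  Ω-cong {m} {x} {x′} {y} {y′} x≗x′ y≗y′ = begin
    Ω x y           ≡⟨ Ω≡ω-ω x y ⟩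
    ω x y - ω y x   ≡⟨ cong₂ _-_ (ω-cong x≗x′ y≗y′) (ω-cong y≗y′ x≗x′) ⟩
    ω x′ y′ - ω y′ x′ ≡⟨ sym (Ω≡ω-ω x′ y′) ⟩
    Ω x′ y′         ∎
    where
      open ≡-Reasoning
      ℓ-cong : ∀ {u u′ : Vec2 m} → (∀ c → u c ≡ u′ c) → ∀ i → ℓ u i ≡ ℓ u′ i
      ℓ-cong u≗u′ zero = cong₂ (λ a b → a + sgn (suc m) * b) (u≗u′ _) (u≗u′ _)
      ℓ-cong u≗u′ (suc j) = cong₂ _+_ (u≗u′ _) (u≗u′ _)
      ω-cong : ∀ {u u′ v v′ : Vec2 m} → (∀ c → u c ≡ u′ c) → (∀ c → v c ≡ v′ c) → ω u v ≡ ω u′ v′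
      ω-cong u≗u′ v≗v′ = sum-cong {suc m} (λ i → cong₂ _*_ (u≗u′ (i , false)) (ℓ-cong v≗v′ i))

  data InitOrLast {m : ℕ} : Fin (suc m) → Set where
    init : (j : Fin m) → InitOrLast (inject₁ j)
    last : InitOrLast (fromℕ m)

  initOrLast : ∀ {m} (t : Fin (suc m)) → InitOrLast t
  initOrLast {zero} zero = last
  initOrLast {suc m} zero = init zero
  initOrLast {suc m} (suc t) with initOrLast t
  ... | init j = init (suc j)
  ... | last = last

  δ-inject₁ : ∀ {m} (a b : Fin m) → δ (inject₁ a) (inject₁ b) ≡ δ a b
  δ-inject₁ a b with a Fin.≟ b
  ... | yes refl = δ-refl _
  ... | no a≢b = δ-≢ (a≢b ∘ Fin.inject₁-injective)

  ϰ-inject₁ : ∀ {m} (x : Vec2 m) (t : Fin m) → ϰ x (inject₁ t) ≡ x (inject₁ t , false) + x (suc t , false)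
  ϰ-inject₁ {m} x t = begin
    x (inject₁ t , false) + sumFin (λ (j : Fin m) → δ (inject₁ j) (inject₁ t) * x (suc j , false)) + δ (fromℕ m) (inject₁ t) * (s * x₀)
      ≡⟨ cong₂ (λ a b → x (inject₁ t , false) + a + b * (s * x₀))
               (trans (sum-cong {m} (λ j → trans (cong (_* x (suc j , false)) (δ-inject₁ j t)) (*-comm _ _))) (sum-δʳ (λ j → x (suc j , false)) t))
               (δ-≢ Fin.fromℕ≢inject₁) ⟩
    x (inject₁ t , false) + x (suc t , false) + 0# * (s * x₀)
      ≡⟨ trans (cong (x (inject₁ t , false) + x (suc t , false) +_) (zeroˡ _)) (+-identityʳ _) ⟩
    x (inject₁ t , false) + x (suc t , false) ∎
    where
      open ≡-Reasoning
      s = sgn (suc m)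
      x₀ = x (zero , false)

  ϰ-fromℕ : ∀ {m} (x : Vec2 m) → ϰ x (fromℕ m) ≡ x (fromℕ m , false) + sgn (suc m) * x (zero , false)
  ϰ-fromℕ {m} x = begin
    x (fromℕ m , false) + sumFin (λ (j : Fin m) → δ (inject₁ j) (fromℕ m) * x (suc j , false)) + δ (fromℕ m) (fromℕ m) * (s * x₀)
      ≡⟨ cong₂ (λ a b → x (fromℕ m , false) + a + b * (s * x₀))
               (sum-zeros {m} (λ j → trans (cong (_* x (suc j , false)) (δ-≢ (Fin.fromℕ≢inject₁ ∘ sym))) (zeroˡ _)))
               (δ-refl (fromℕ m)) ⟩
    x (fromℕ m , false) + 0# + 1# * (s * x₀)
      ≡⟨ cong₂ _+_ (+-identityʳ _) (*-identityˡ _) ⟩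
    x (fromℕ m , false) + s * x₀ ∎
    where
      open ≡-Reasoning
      s = sgn (suc m)
      x₀ = x (zero , false)

  -- Orthogonality to the yₜ makes ℓ x (resp. ϰ x) vanish, i.e. neighbouring coordinates of x are opposite.
  alternating-tilde : ∀ {m} (x : Vec2 m) (y : Fin (suc m) → Vec2 m) →
    (∀ j → x (j , false) ≡ 0#) → (∀ t j → y t (j , false) ≡ δ t j) → (∀ t → Ω x (y t) ≡ 0#) →
    ∀ j → x (j , true) ≡ sgn (toℕ j) * x (zero , true)
  alternating-tilde {m} x y x-plain≡0 y-plain≡δ x⊥y =
    alternating (λ j → x (j , true)) (λ j → x+y≡0⇒x≡-y (ℓx≡0 (suc j)))
    where
      ℓx≡0 : ∀ t → ℓ x t ≡ 0#
      ℓx≡0 t = -x≡0⇒x≡0 (begin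
        - ℓ x t                  ≡⟨ sym (+-identityˡ _) ⟩
        0# - ℓ x t               ≡⟨ cong₂ _-_ (sym (sum-zeros {suc m} (λ i → trans (cong (_* ℓ (y t) i) (x-plain≡0 i)) (zeroˡ _))))
                                              (sym (trans (sum-cong {suc m} (λ i → cong (_* ℓ x i) (y-plain≡δ t i))) (sum-δˡ (ℓ x) t))) ⟩
        ω x (y t) - ω (y t) x    ≡⟨ sym (Ω≡ω-ω x (y t)) ⟩
        Ω x (y t)                ≡⟨ x⊥y t ⟩
        0#                       ∎)
        where open ≡-Reasoning

  alternating-plain : ∀ {m} (x : Vec2 m) (y : Fin (suc m) → Vec2 m) →
    (∀ j → x (j , true) ≡ 0#) → (∀ t j → y t (j , true) ≡ δ t j) → (∀ t → Ω x (y t) ≡ 0#) →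
    ∀ j → x (j , false) ≡ sgn (toℕ j) * x (zero , false)
  alternating-plain {m} x y x-tilde≡0 y-tilde≡δ x⊥y =
    alternating (λ j → x (j , false)) (λ j → x+y≡0⇒x≡-y (trans (+-comm _ _) (trans (sym (ϰ-inject₁ x j)) (ϰx≡0 (inject₁ j)))))
    where
      ℓx≡0 : ∀ t → ℓ x t ≡ 0#
      ℓx≡0 zero = trans (cong₂ (λ a b → a + sgn (suc m) * b) (x-tilde≡0 zero) (x-tilde≡0 (fromℕ m)))
                        (trans (cong (0# +_) (zeroʳ _)) (+-identityˡ 0#))
      ℓx≡0 (suc j) = trans (cong₂ _+_ (x-tilde≡0 (suc j)) (x-tilde≡0 (inject₁ j))) (+-identityˡ 0#)
      ϰx≡0 : ∀ t → ϰ x t ≡ 0#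
      ϰx≡0 t = begin
        ϰ x t                               ≡⟨ sym (sum-δˡ (ϰ x) t) ⟩
        sumFin (λ i → δ t i * ϰ x i)        ≡⟨ sym (sum-cong {suc m} (λ i → cong (_* ϰ x i) (y-tilde≡δ t i))) ⟩
        sumFin (λ i → y t (i , true) * ϰ x i) ≡⟨ sym (ω≡Σϰ x (y t)) ⟩
        ω x (y t)                           ≡⟨ sym (+-identityʳ _) ⟩
        ω x (y t) + 0#                      ≡⟨ cong (ω x (y t) +_) (trans (sym -0#≈0#) (cong -_ (sym ω[y,x]≡0))) ⟩
        ω x (y t) - ω (y t) x               ≡⟨ sym (Ω≡ω-ω x (y t)) ⟩
        Ω x (y t)                           ≡⟨ x⊥y t ⟩
        0#                                  ∎
        where
          open ≡-Reasoning
          ω[y,x]≡0 : ω (y t) x ≡ 0#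
          ω[y,x]≡0 = sum-zeros {suc m} (λ i → trans (cong (y t (i , false) *_) (ℓx≡0 i)) (zeroʳ _))

module Charts (ℝ : RealField) where
  open SkewForm ℝ public

  MD : ∀ {n} → Sq n → Mat n
  MD S = timesD (M S)

  M′D : ∀ {n} → Sq n → Mat n
  M′D T = timesD (M′ T)

  sgn-fromℕ : ∀ m → sgn (toℕ (fromℕ m)) ≡ sgn m
  sgn-fromℕ m = cong sgn (Fin.toℕ-fromℕ m)

  sgn-inject₁ : ∀ {m} (j : Fin m) → sgn (toℕ (inject₁ j)) ≡ sgn (toℕ j)
  sgn-inject₁ j = cong sgn (Fin.toℕ-inject₁ j)

  sgn²-cancel : ∀ k a b → a * (sgn k * sgn k) - b * (sgn k * sgn k) ≡ a - b
  sgn²-cancel k a b = cong₂ _-_ (trans (cong (a *_) (sgn²≡1 k)) (*-identityʳ a)) (trans (cong (b *_) (sgn²≡1 k)) (*-identityʳ b))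

  ω-MD : ∀ {m} (S : Sq (suc m)) a (y : Vec2 m) → ω (MD S (suc a)) y ≡ sgn (toℕ a) * ℓ y a
  ω-MD {m} S a y = trans (sum-cong {suc m} (λ i → *-assoc (δ a i) (sgn (toℕ i)) (ℓ y i))) (sum-δˡ (λ i → sgn (toℕ i) * ℓ y i) a)

  ℓ-MD : ∀ {m} (S : Sq (suc m)) a b → sgn (toℕ a) * ℓ (MD S (suc b)) a ≡ S b a - S b (cpred a)
  ℓ-MD {m} S zero b = begin
    1# * (S b zero * 1# + sgn (suc m) * (S b (fromℕ m) * sgn (toℕ (fromℕ m))))
      ≡⟨ cong (λ z → 1# * (S b zero * 1# + (- sgn m) * (S b (fromℕ m) * z))) (sgn-fromℕ m) ⟩
    1# * (S b zero * 1# + (- sgn m) * (S b (fromℕ m) * sgn m))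
      ≡⟨ *-identityˡ _ ⟩
    S b zero * 1# + (- sgn m) * (S b (fromℕ m) * sgn m)
      ≡⟨ solve 4 (λ o A u B → A :* o :+ (:- u) :* (B :* u) := A :* o :- B :* (u :* u)) refl 1# (S b zero) (sgn m) (S b (fromℕ m)) ⟩
    S b zero * 1# - S b (fromℕ m) * (sgn m * sgn m)
      ≡⟨ cong (λ y → S b zero * 1# - S b (fromℕ m) * y) (sgn²≡1 m) ⟩
    S b zero * 1# - S b (fromℕ m) * 1#
      ≡⟨ cong₂ _-_ (*-identityʳ _) (trans (*-identityʳ _) (cong (S b) (sym cpred-zero))) ⟩
    S b zero - S b (cpred zero) ∎
    where open ≡-Reasoning
  ℓ-MD {m} S (suc j) b = begin
    (- sgn (toℕ j)) * (S b (suc j) * (- sgn (toℕ j)) + S b (inject₁ j) * sgn (toℕ (inject₁ j)))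
      ≡⟨ cong (λ z → (- sgn (toℕ j)) * (S b (suc j) * (- sgn (toℕ j)) + S b (inject₁ j) * z)) (sgn-inject₁ j) ⟩
    (- sgn (toℕ j)) * (S b (suc j) * (- sgn (toℕ j)) + S b (inject₁ j) * sgn (toℕ j))
      ≡⟨ solve 3 (λ u A B → (:- u) :* (A :* (:- u) :+ B :* u) := A :* (u :* u) :- B :* (u :* u)) refl (sgn (toℕ j)) (S b (suc j)) (S b (inject₁ j)) ⟩
    S b (suc j) * (sgn (toℕ j) * sgn (toℕ j)) - S b (inject₁ j) * (sgn (toℕ j) * sgn (toℕ j))
      ≡⟨ sgn²-cancel (toℕ j) (S b (suc j)) (S b (inject₁ j)) ⟩
    S b (suc j) - S b (inject₁ j)
      ≡⟨ cong (λ z → S b (suc j) - S b z) (sym (cpred-suc j)) ⟩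
    S b (suc j) - S b (cpred (suc j)) ∎
    where open ≡-Reasoning

  Ω-MD : ∀ {m} (S : Sq (suc m)) a b → Ω (MD S (suc a)) (MD S (suc b)) ≡ Pmat S b a - Pmat S a b
  Ω-MD S a b = begin
    Ω (MD S (suc a)) (MD S (suc b))
      ≡⟨ Ω≡ω-ω (MD S (suc a)) (MD S (suc b)) ⟩
    ω (MD S (suc a)) (MD S (suc b)) - ω (MD S (suc b)) (MD S (suc a))
      ≡⟨ cong₂ _-_ (trans (ω-MD S a (MD S (suc b))) (ℓ-MD S a b)) (trans (ω-MD S b (MD S (suc a))) (ℓ-MD S b a)) ⟩
    (S b a - S b (cpred a)) - (S a b - S a (cpred b))
      ≡⟨ solve 4 (λ w x y z → (w :- x) :- (y :- z) := (z :- y) :- (x :- w)) refl (S b a) (S b (cpred a)) (S a b) (S a (cpred b)) ⟩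
    Pmat S b a - Pmat S a b ∎
    where open ≡-Reasoning

  Ω-MD₀ : ∀ {m} (S : Sq (suc m)) b → Ω (MD S zero) (MD S (suc b)) ≡ 0#
  Ω-MD₀ {m} S b = begin
    Ω (MD S zero) (MD S (suc b))
      ≡⟨ Ω≡ω-ω (MD S zero) (MD S (suc b)) ⟩
    ω (MD S zero) (MD S (suc b)) - ω (MD S (suc b)) (MD S zero)
      ≡⟨ cong₂ _-_ (sum-zeros {suc m} (λ i → trans (cong (_* ℓ (MD S (suc b)) i) (zeroˡ (sgn (toℕ i)))) (zeroˡ _)))
                   (trans (ω-MD S b (MD S zero)) (trans (cong (sgn (toℕ b) *_) (ℓ₀≡0 b)) (zeroʳ _))) ⟩
    0# - 0#
      ≡⟨ -‿inverseʳ 0# ⟩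
    0# ∎
    where
      open ≡-Reasoning
      ℓ₀≡0 : ∀ t → ℓ (MD S zero) t ≡ 0#
      ℓ₀≡0 zero = begin
        1# * 1# + (- sgn m) * (1# * sgn (toℕ (fromℕ m))) ≡⟨ cong (λ z → 1# * 1# + (- sgn m) * (1# * z)) (sgn-fromℕ m) ⟩
        1# * 1# + (- sgn m) * (1# * sgn m)
          ≡⟨ solve 2 (λ o u → o :* o :+ (:- u) :* (o :* u) := o :* o :- o :* (u :* u)) refl 1# (sgn m) ⟩
        1# * 1# - 1# * (sgn m * sgn m)                   ≡⟨ cong (λ z → 1# * 1# - 1# * z) (sgn²≡1 m) ⟩
        1# * 1# - 1# * 1#                                ≡⟨ -‿inverseʳ _ ⟩
        0#                                               ∎
      ℓ₀≡0 (suc j) = begin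
        1# * (- sgn (toℕ j)) + 1# * sgn (toℕ (inject₁ j)) ≡⟨ cong (λ z → 1# * (- sgn (toℕ j)) + 1# * z) (sgn-inject₁ j) ⟩
        1# * (- sgn (toℕ j)) + 1# * sgn (toℕ j)           ≡⟨ solve 2 (λ o u → o :* (:- u) :+ o :* u := o :* u :- o :* u) refl 1# (sgn (toℕ j)) ⟩
        1# * sgn (toℕ j) - 1# * sgn (toℕ j)               ≡⟨ -‿inverseʳ _ ⟩
        0#                                                ∎

  ω-M′D : ∀ {m} (T : Sq (suc m)) b (x : Vec2 m) → ω x (M′D T (suc b)) ≡ sgn (toℕ b) * ϰ x b
  ω-M′D {m} T b x = trans (ω≡Σϰ x (M′D T (suc b)))
    (trans (sum-cong {suc m} (λ i → *-assoc (δ b i) (sgn (toℕ i)) (ϰ x i))) (sum-δˡ (λ i → sgn (toℕ i) * ϰ x i) b))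

  ϰ-M′D : ∀ {m} (T : Sq (suc m)) a t → sgn (toℕ t) * ϰ (M′D T (suc a)) t ≡ T a t - T a (csuc t)
  ϰ-M′D {m} T a t with initOrLast t
  ... | init j = begin
    sgn (toℕ (inject₁ j)) * ϰ (M′D T (suc a)) (inject₁ j)
      ≡⟨ cong₂ _*_ (sgn-inject₁ j) (ϰ-inject₁ (M′D T (suc a)) j) ⟩
    sgn (toℕ j) * (T a (inject₁ j) * sgn (toℕ (inject₁ j)) + T a (suc j) * (- sgn (toℕ j)))
      ≡⟨ cong (λ z → sgn (toℕ j) * (T a (inject₁ j) * z + T a (suc j) * (- sgn (toℕ j)))) (sgn-inject₁ j) ⟩
    sgn (toℕ j) * (T a (inject₁ j) * sgn (toℕ j) + T a (suc j) * (- sgn (toℕ j)))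
      ≡⟨ solve 3 (λ u A B → u :* (A :* u :+ B :* (:- u)) := A :* (u :* u) :- B :* (u :* u)) refl (sgn (toℕ j)) (T a (inject₁ j)) (T a (suc j)) ⟩
    T a (inject₁ j) * (sgn (toℕ j) * sgn (toℕ j)) - T a (suc j) * (sgn (toℕ j) * sgn (toℕ j))
      ≡⟨ sgn²-cancel (toℕ j) (T a (inject₁ j)) (T a (suc j)) ⟩
    T a (inject₁ j) - T a (suc j)
      ≡⟨ cong (λ z → T a (inject₁ j) - T a z) (sym (csuc-inject₁ j)) ⟩
    T a (inject₁ j) - T a (csuc (inject₁ j)) ∎
    where open ≡-Reasoning
  ... | last = begin
    sgn (toℕ (fromℕ m)) * ϰ (M′D T (suc a)) (fromℕ m)
      ≡⟨ cong₂ _*_ (sgn-fromℕ m) (ϰ-fromℕ (M′D T (suc a))) ⟩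
    sgn m * (T a (fromℕ m) * sgn (toℕ (fromℕ m)) + (- sgn m) * (T a zero * 1#))
      ≡⟨ cong₂ (λ z w → sgn m * (T a (fromℕ m) * z + (- sgn m) * w)) (sgn-fromℕ m) (*-identityʳ _) ⟩
    sgn m * (T a (fromℕ m) * sgn m + (- sgn m) * T a zero)
      ≡⟨ solve 3 (λ u A B → u :* (A :* u :+ (:- u) :* B) := A :* (u :* u) :- B :* (u :* u)) refl (sgn m) (T a (fromℕ m)) (T a zero) ⟩
    T a (fromℕ m) * (sgn m * sgn m) - T a zero * (sgn m * sgn m)
      ≡⟨ sgn²-cancel m (T a (fromℕ m)) (T a zero) ⟩
    T a (fromℕ m) - T a zero
      ≡⟨ cong (λ z → T a (fromℕ m) - T a z) (sym csuc-fromℕ) ⟩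
    T a (fromℕ m) - T a (csuc (fromℕ m)) ∎
    where open ≡-Reasoning

  Ω-M′D : ∀ {m} (T : Sq (suc m)) a b → Ω (M′D T (suc a)) (M′D T (suc b)) ≡ Qmat T a b - Qmat T b a
  Ω-M′D T a b = begin
    Ω (M′D T (suc a)) (M′D T (suc b))
      ≡⟨ Ω≡ω-ω (M′D T (suc a)) (M′D T (suc b)) ⟩
    ω (M′D T (suc a)) (M′D T (suc b)) - ω (M′D T (suc b)) (M′D T (suc a))
      ≡⟨ cong₂ _-_ (trans (ω-M′D T b (M′D T (suc a))) (ϰ-M′D T a b)) (trans (ω-M′D T a (M′D T (suc b))) (ϰ-M′D T b a)) ⟩
    (T a b - T a (csuc b)) - (T b a - T b (csuc a))
      ≡⟨ solve 4 (λ w x y z → (w :- x) :- (y :- z) := (z :- y) :- (x :- w)) refl (T a b) (T a (csuc b)) (T b a) (T b (csuc a)) ⟩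
    Qmat T a b - Qmat T b a ∎
    where open ≡-Reasoning


  Pmat-colSums : ∀ {m} (S : Sq (suc m)) b → sumFin (λ a → Pmat S a b) ≡ 0#
  Pmat-colSums S b = trans (sum-difference (λ a → S b (cpred a)) (S b)) (trans (cong (_- sumFin (S b)) (sum-cpred (S b))) (-‿inverseʳ _))

  Qmat-colSums : ∀ {m} (T : Sq (suc m)) b → sumFin (λ a → Qmat T a b) ≡ 0#
  Qmat-colSums T b = trans (sum-difference (λ a → T b (csuc a)) (T b)) (trans (cong (_- sumFin (T b)) (sum-csuc (T b))) (-‿inverseʳ _))

  symZeroSums : ∀ {n} (P : Sq n) → (∀ a b → P a b ≡ P b a) → (∀ b → sumFin (λ a → P a b) ≡ 0#) → SymZeroSums P
  symZeroSums {n} P P-sym colSums = P-sym , (λ a → trans (sum-cong {n} (λ b → P-sym a b)) (colSums a)) , colSums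

  Pmat-symZeroSums : ∀ {m} (S : Sq (suc m)) → Isotropic (MD S) → SymZeroSums (Pmat S)
  Pmat-symZeroSums S iso = symZeroSums (Pmat S) (λ a b → sym (x-y≡0⇒x≡y (trans (sym (Ω-MD S a b)) (iso (suc a) (suc b)))))
                                   (Pmat-colSums S)

  Qmat-symZeroSums : ∀ {m} (T : Sq (suc m)) → Isotropic (M′D T) → SymZeroSums (Qmat T)
  Qmat-symZeroSums T iso = symZeroSums (Qmat T) (λ a b → x-y≡0⇒x≡y (trans (sym (Ω-M′D T a b)) (iso (suc a) (suc b))))
                                   (Qmat-colSums T)

  MD-isotropic : ∀ {m} (S : Sq (suc m)) → (∀ a b → Pmat S a b ≡ Pmat S b a) → Isotropic (MD S)
  MD-isotropic S P-sym zero zero = Ω-self (MD S zero)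
  MD-isotropic S P-sym zero (suc b) = Ω-MD₀ S b
  MD-isotropic S P-sym (suc a) zero = trans (Ω-antisym (MD S (suc a)) (MD S zero)) (trans (cong -_ (Ω-MD₀ S a)) -0#≈0#)
  MD-isotropic S P-sym (suc a) (suc b) = trans (Ω-MD S a b) (trans (cong (_- Pmat S a b) (P-sym b a)) (-‿inverseʳ _))

  RowCombination : ∀ {n} → Mat n → Mat n → Set
  RowCombination {n} X Y = ∃ λ (G : Fin (suc n) → Fin (suc n) → Carrier) → ∀ r c → X r c ≡ sumFin (λ k → G r k * Y k c)

  rowCombination-refl : ∀ {n} (X : Mat n) → RowCombination X X
  rowCombination-refl X = δ , λ r c → sym (sum-δˡ (λ k → X k c) r)

  rowCombination-trans : ∀ {n} {X Y Z : Mat n} → RowCombination X Y → RowCombination Y Z → RowCombination X Z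
  rowCombination-trans {n} {X} {Y} {Z} (F , X≡FY) (G , Y≡GZ) = (λ r l → sumFin (λ k → F r k * G k l)) , λ r c → begin
    X r c
      ≡⟨ X≡FY r c ⟩
    sumFin (λ k → F r k * Y k c)
      ≡⟨ sum-cong {suc n} (λ k → trans (cong (F r k *_) (Y≡GZ k c)) (sym (sum-*ˡ (F r k) (λ l → G k l * Z l c)))) ⟩
    sumFin (λ k → sumFin (λ l → F r k * (G k l * Z l c)))
      ≡⟨ sum-comm (λ k l → F r k * (G k l * Z l c)) ⟩
    sumFin (λ l → sumFin (λ k → F r k * (G k l * Z l c)))
      ≡⟨ sum-cong {suc n} (λ l → trans (sum-cong {suc n} (λ k → sym (*-assoc (F r k) (G k l) (Z l c)))) (sum-*ʳ (Z l c) (λ k → F r k * G k l))) ⟩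
    sumFin (λ l → sumFin (λ k → F r k * G k l) * Z l c) ∎
    where open ≡-Reasoning

  sameSpan-refl : ∀ {n} (X : Mat n) → SameSpan X X
  sameSpan-refl X = rowCombination-refl X , rowCombination-refl X

  sameSpan-sym : ∀ {n} {X Y : Mat n} → SameSpan X Y → SameSpan Y X
  sameSpan-sym (X∈Y , Y∈X) = Y∈X , X∈Y

  sameSpan-trans : ∀ {n} {X Y Z : Mat n} → SameSpan X Y → SameSpan Y Z → SameSpan X Z
  sameSpan-trans {X = X} {Y} {Z} (X∈Y , Y∈X) (Y∈Z , Z∈Y) =
    rowCombination-trans {X = X} {Y} {Z} X∈Y Y∈Z , rowCombination-trans {X = Z} {Y} {X} Z∈Y Y∈X

  isotropic-rowCombination : ∀ {m} {X Y : Mat (suc m)} → RowCombination X Y → Isotropic Y → Isotropic X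
  isotropic-rowCombination {X = X} {Y} (G , X≡GY) iso r s =
    trans (Ω-cong {x = X r} {lincomb (G r) Y} {X s} {lincomb (G s) Y} (X≡GY r) (X≡GY s))
          (Ω-lincomb-isotropic Y iso (G r) (G s))

  rowSign : ∀ {m} → Fin (suc (suc m)) → Carrier
  rowSign zero = 1#
  rowSign (suc i) = sgn (toℕ i)

  rowSign²≡1 : ∀ {m} (r : Fin (suc (suc m))) → rowSign r * rowSign r ≡ 1#
  rowSign²≡1 zero = *-identityˡ 1#
  rowSign²≡1 (suc i) = sgn²≡1 (toℕ i)

  sameSpan-rowSign : ∀ {m} (A X R : Mat (suc m)) → RowCombination A R → RowCombination R A →
    (∀ r c → X r c ≡ rowSign r * R r c) → SameSpan A X
  sameSpan-rowSign {m} A X R (G , A≡GR) (C , R≡CA) X≡±R =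
    ((λ r s → G r s * rowSign s) , λ r c → trans (A≡GR r c) (sum-cong {suc (suc m)} λ s →
       trans (cong (G r s *_) (R≡±X s c)) (sym (*-assoc (G r s) (rowSign s) (X s c))))) ,
    ((λ r t → rowSign r * C r t) , λ r c → begin
       X r c                                    ≡⟨ X≡±R r c ⟩
       rowSign r * R r c                        ≡⟨ cong (rowSign r *_) (R≡CA r c) ⟩
       rowSign r * sumFin (λ t → C r t * A t c) ≡⟨ sym (sum-*ˡ (rowSign r) (λ t → C r t * A t c)) ⟩
       sumFin (λ t → rowSign r * (C r t * A t c)) ≡⟨ sum-cong {suc (suc m)} (λ t → sym (*-assoc (rowSign r) (C r t) (A t c))) ⟩
       sumFin (λ t → rowSign r * C r t * A t c) ∎)
    where
      open ≡-Reasoning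
      R≡±X : ∀ s c → R s c ≡ rowSign s * X s c
      R≡±X s c = sym (begin
        rowSign s * X s c                   ≡⟨ cong (rowSign s *_) (X≡±R s c) ⟩
        rowSign s * (rowSign s * R s c)     ≡⟨ sym (*-assoc _ _ _) ⟩
        (rowSign s * rowSign s) * R s c     ≡⟨ cong (_* R s c) (rowSign²≡1 s) ⟩
        1# * R s c                          ≡⟨ *-identityˡ _ ⟩
        R s c                               ∎)

  module Reduction {m} (A : Mat (suc m)) (iso : Isotropic A)
                   (cols : Fin (suc (suc m)) → Col (suc m)) (minor≢0 : minor A cols ≢ 0#) where
    C : Sq (suc (suc m))
    C = proj₁ (det≢0⇒leftInverse (λ r s → A r (cols s)) minor≢0)

    R : Mat (suc m)
    R r = lincomb (C r) A

    R-cols : ∀ r s → R r (cols s) ≡ δ r s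
    R-cols = proj₂ (det≢0⇒leftInverse (λ r s → A r (cols s)) minor≢0)

    R∈A : RowCombination R A
    R∈A = C , λ r c → refl

    R-isotropic : Isotropic R
    R-isotropic = isotropic-rowCombination {X = R} {Y = A} R∈A iso

    residualCoeffs : Fin (suc (suc m)) → Fin (suc (suc m)) → Carrier
    residualCoeffs r k = δ r k - sumFin (λ s → A r (cols s) * C s k)

    residual : Fin (suc (suc m)) → Vec2 m
    residual r = lincomb (residualCoeffs r) A

    residual≡ : ∀ r c → residual r c ≡ A r c - sumFin (λ s → A r (cols s) * R s c)
    residual≡ r c = begin
      sumFin (λ k → (δ r k - coeff k) * A k c)
        ≡⟨ sum-cong {suc (suc m)} (λ k → solve 3 (λ d x a → (d :- x) :* a := d :* a :- x :* a) refl (δ r k) (coeff k) (A k c)) ⟩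
      sumFin (λ k → δ r k * A k c - coeff k * A k c)
        ≡⟨ sum-difference (λ k → δ r k * A k c) (λ k → coeff k * A k c) ⟩
      sumFin (λ k → δ r k * A k c) - sumFin (λ k → coeff k * A k c)
        ≡⟨ cong₂ _-_ (sum-δˡ (λ k → A k c) r) regroup ⟩
      A r c - sumFin (λ s → A r (cols s) * R s c) ∎
      where
        open ≡-Reasoning
        coeff : Fin (suc (suc m)) → Carrier
        coeff k = sumFin (λ s → A r (cols s) * C s k)
        regroup : sumFin (λ k → coeff k * A k c) ≡ sumFin (λ s → A r (cols s) * R s c)
        regroup = begin
          sumFin (λ k → coeff k * A k c)
            ≡⟨ sum-cong {suc (suc m)} (λ k → trans (sym (sum-*ʳ (A k c) (λ s → A r (cols s) * C s k)))
                                                   (sum-cong {suc (suc m)} (λ s → *-assoc (A r (cols s)) (C s k) (A k c)))) ⟩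
          sumFin (λ k → sumFin (λ s → A r (cols s) * (C s k * A k c)))
            ≡⟨ sum-comm (λ k s → A r (cols s) * (C s k * A k c)) ⟩
          sumFin (λ s → sumFin (λ k → A r (cols s) * (C s k * A k c)))
            ≡⟨ sum-cong {suc (suc m)} (λ s → sum-*ˡ (A r (cols s)) (λ k → C s k * A k c)) ⟩
          sumFin (λ s → A r (cols s) * R s c) ∎

    residual-cols : ∀ r s → residual r (cols s) ≡ 0#
    residual-cols r s = begin
      residual r (cols s)
        ≡⟨ residual≡ r (cols s) ⟩
      A r (cols s) - sumFin (λ s′ → A r (cols s′) * R s′ (cols s))
        ≡⟨ cong (λ z → A r (cols s) - z) (trans (sum-cong {suc (suc m)} (λ s′ → cong (A r (cols s′) *_) (R-cols s′ s)))
                                                 (sum-δʳ (λ s′ → A r (cols s′)) s)) ⟩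
      A r (cols s) - A r (cols s)
        ≡⟨ -‿inverseʳ _ ⟩
      0# ∎
      where open ≡-Reasoning

    residual⊥R : ∀ r t → Ω (residual r) (R t) ≡ 0#
    residual⊥R r t = Ω-lincomb-isotropic A iso (residualCoeffs r) (C t)

    residual≡0⇒A∈R : (∀ r c → residual r c ≡ 0#) → RowCombination A R
    residual≡0⇒A∈R residual≡0 = (λ r s → A r (cols s)) , λ r c → x-y≡0⇒x≡y (trans (sym (residual≡ r c)) (residual≡0 r c))

  MD-chart : ∀ {m} (A : Mat (suc m)) → Isotropic A → minor A (colsNS zero) ≢ 0# → ∃ λ S → SameSpan A (MD S)
  MD-chart {m} A iso minor≢0 = S , sameSpan-rowSign A (MD S) R (residual≡0⇒A∈R residual≡0) R∈A MD≡±R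
    where
      open Reduction A iso (colsNS zero) minor≢0

      R-plain : ∀ t j → R (suc t) (j , false) ≡ δ t j
      R-plain t j = trans (R-cols (suc t) (suc j)) (δ-suc t j)

      R₀-tilde : ∀ j → R zero (j , true) ≡ sgn (toℕ j) * 1#
      R₀-tilde j = trans (alternating-tilde (R zero) (R ∘ suc) (λ j → trans (R-cols zero (suc j)) (δ-zero-suc j)) R-plain
                                            (λ t → R-isotropic zero (suc t)) j)
                         (cong (sgn (toℕ j) *_) (trans (R-cols zero zero) (δ-refl {suc (suc m)} zero)))

      S : Sq (suc m)
      S i j = sgn (toℕ i) * R (suc i) (j , true) * sgn (toℕ j)

      MD≡±R : ∀ r c → MD S r c ≡ rowSign r * R r c
      MD≡±R zero (j , false) = trans (zeroˡ _) (sym (trans (cong (1# *_) (trans (R-cols zero (suc j)) (δ-zero-suc j))) (zeroʳ _)))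
      MD≡±R zero (j , true) = cong (1# *_) (sym (trans (R₀-tilde j) (*-identityʳ _)))
      MD≡±R (suc i) (j , false) = trans (δ-* i j (λ q → sgn (toℕ q))) (cong (sgn (toℕ i) *_) (sym (R-plain i j)))
      MD≡±R (suc i) (j , true) = begin
        sgn (toℕ i) * R (suc i) (j , true) * sgn (toℕ j) * sgn (toℕ j)   ≡⟨ *-assoc _ _ _ ⟩
        sgn (toℕ i) * R (suc i) (j , true) * (sgn (toℕ j) * sgn (toℕ j)) ≡⟨ cong (sgn (toℕ i) * R (suc i) (j , true) *_) (sgn²≡1 (toℕ j)) ⟩
        sgn (toℕ i) * R (suc i) (j , true) * 1#                          ≡⟨ *-identityʳ _ ⟩
        sgn (toℕ i) * R (suc i) (j , true)                               ∎
        where open ≡-Reasoning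

      residual≡0 : ∀ r c → residual r c ≡ 0#
      residual≡0 r (j , false) = residual-cols r (suc j)
      residual≡0 r (j , true) =
        trans (alternating-tilde (residual r) (R ∘ suc) (λ j → residual-cols r (suc j)) R-plain (residual⊥R r ∘ suc) j)
              (trans (cong (sgn (toℕ j) *_) (residual-cols r zero)) (zeroʳ _))

  M′D-chart : ∀ {m} (A : Mat (suc m)) → Isotropic A → minor A (colsC zero) ≢ 0# → ∃ λ T → SameSpan A (M′D T)
  M′D-chart {m} A iso minor≢0 = T , sameSpan-rowSign A (M′D T) R (residual≡0⇒A∈R residual≡0) R∈A M′D≡±R
    where
      open Reduction A iso (colsC zero) minor≢0

      R-tilde : ∀ t j → R (suc t) (j , true) ≡ δ t j
      R-tilde t j = trans (R-cols (suc t) (suc j)) (δ-suc t j)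

      R₀-plain : ∀ j → R zero (j , false) ≡ sgn (toℕ j) * 1#
      R₀-plain j = trans (alternating-plain (R zero) (R ∘ suc) (λ j → trans (R-cols zero (suc j)) (δ-zero-suc j)) R-tilde
                                            (λ t → R-isotropic zero (suc t)) j)
                         (cong (sgn (toℕ j) *_) (trans (R-cols zero zero) (δ-refl {suc (suc m)} zero)))

      T : Sq (suc m)
      T i j = sgn (toℕ i) * R (suc i) (j , false) * sgn (toℕ j)

      M′D≡±R : ∀ r c → M′D T r c ≡ rowSign r * R r c
      M′D≡±R zero (j , true) = trans (zeroˡ _) (sym (trans (cong (1# *_) (trans (R-cols zero (suc j)) (δ-zero-suc j))) (zeroʳ _)))
      M′D≡±R zero (j , false) = cong (1# *_) (sym (trans (R₀-plain j) (*-identityʳ _)))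
      M′D≡±R (suc i) (j , true) = trans (δ-* i j (λ q → sgn (toℕ q))) (cong (sgn (toℕ i) *_) (sym (R-tilde i j)))
      M′D≡±R (suc i) (j , false) = begin
        sgn (toℕ i) * R (suc i) (j , false) * sgn (toℕ j) * sgn (toℕ j)   ≡⟨ *-assoc _ _ _ ⟩
        sgn (toℕ i) * R (suc i) (j , false) * (sgn (toℕ j) * sgn (toℕ j)) ≡⟨ cong (sgn (toℕ i) * R (suc i) (j , false) *_) (sgn²≡1 (toℕ j)) ⟩
        sgn (toℕ i) * R (suc i) (j , false) * 1#                          ≡⟨ *-identityʳ _ ⟩
        sgn (toℕ i) * R (suc i) (j , false)                               ∎
        where open ≡-Reasoning

      residual≡0 : ∀ r c → residual r c ≡ 0#
      residual≡0 r (j , true) = residual-cols r (suc j)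
      residual≡0 r (j , false) =
        trans (alternating-plain (residual r) (R ∘ suc) (λ j → residual-cols r (suc j)) R-tilde (residual⊥R r ∘ suc) j)
              (trans (cong (sgn (toℕ j) *_) (residual-cols r zero)) (zeroʳ _))

  rowShift-sym : ∀ {n} {S S′ : Sq n} → RowShift S S′ → RowShift S′ S
  rowShift-sym {S = S} (c , S′≡S+c) = (λ i → - c i) , λ i j →
    sym (trans (cong (_- c i) (S′≡S+c i j)) (solve 2 (λ s c → (s :+ c) :- c := s) refl (S i j) (c i)))

  -- Adding c i to row i of S adds c i times the first row of M D to its row i.
  rowShift⇒rowCombination : ∀ {m} (S S′ : Sq (suc m)) → RowShift S S′ → RowCombination (MD S′) (MD S)
  rowShift⇒rowCombination {m} S S′ (c , S′≡S+c) = F , MD′≡FMD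
    where
      F : Fin (suc (suc m)) → Fin (suc (suc m)) → Carrier
      F zero k = δ zero k
      F (suc i) k = δ (suc i) k + δ zero k * c i

      row₀ : ∀ col → MD S′ zero col ≡ MD S zero col
      row₀ (j , false) = refl
      row₀ (j , true) = refl

      row₊ : ∀ i col → MD S′ (suc i) col ≡ MD S (suc i) col + c i * MD S zero col
      row₊ i (j , false) = sym (trans (cong (δ i j * sgn (toℕ j) +_) (trans (cong (c i *_) (zeroˡ _)) (zeroʳ _))) (+-identityʳ _))
      row₊ i (j , true) = trans (cong (_* sgn (toℕ j)) (S′≡S+c i j))
                                (trans (distribʳ _ _ _) (cong (S i j * sgn (toℕ j) +_) (cong (c i *_) (sym (*-identityˡ _)))))

      MD′≡FMD : ∀ r col → MD S′ r col ≡ sumFin (λ k → F r k * MD S k col)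
      MD′≡FMD zero col = trans (row₀ col) (sym (sum-δˡ (λ k → MD S k col) zero))
      MD′≡FMD (suc i) col = trans (row₊ i col) (sym (begin
        sumFin (λ k → (δ (suc i) k + δ zero k * c i) * MD S k col)
          ≡⟨ sum-cong {suc (suc m)} (λ k → solve 4 (λ d e c x → (d :+ e :* c) :* x := d :* x :+ e :* (c :* x)) refl
                                                  (δ (suc i) k) (δ zero k) (c i) (MD S k col)) ⟩
        sumFin (λ k → δ (suc i) k * MD S k col + δ zero k * (c i * MD S k col))
          ≡⟨ sum-+ (λ k → δ (suc i) k * MD S k col) (λ k → δ zero k * (c i * MD S k col)) ⟩
        sumFin (λ k → δ (suc i) k * MD S k col) + sumFin (λ k → δ zero k * (c i * MD S k col))
          ≡⟨ cong₂ _+_ (sum-δˡ (λ k → MD S k col) (suc i)) (sum-δˡ (λ k → c i * MD S k col) zero) ⟩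
        MD S (suc i) col + c i * MD S zero col ∎))
        where open ≡-Reasoning

  rowShift⇒sameSpan : ∀ {m} (S S′ : Sq (suc m)) → RowShift S S′ → SameSpan (MD S) (MD S′)
  rowShift⇒sameSpan S S′ S~S′ = rowShift⇒rowCombination S′ S (rowShift-sym {S = S} {S′} S~S′) , rowShift⇒rowCombination S S′ S~S′

  -- Comparing plain coordinates forces the combination to be the identity on rows 1..n, and
  -- then the tilde coordinates exhibit the row shift.
  sameSpan⇒rowShift : ∀ {m} (S S′ : Sq (suc m)) → SameSpan (MD S) (MD S′) → RowShift S S′
  sameSpan⇒rowShift {m} S S′ (_ , (K , MD′≡KMD)) = (λ i → K (suc i) zero) , S′≡S+K
    where
      plain : ∀ r j → sumFin (λ k → K r k * MD S k (j , false)) ≡ K r (suc j) * sgn (toℕ j)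
      plain r j = begin
        K r zero * (0# * sgn (toℕ j)) + sumFin (λ i → K r (suc i) * (δ i j * sgn (toℕ j)))
          ≡⟨ cong₂ _+_ (trans (cong (K r zero *_) (zeroˡ _)) (zeroʳ _))
                       (sum-cong {suc m} (λ i → solve 3 (λ k d s → k :* (d :* s) := (k :* s) :* d) refl (K r (suc i)) (δ i j) (sgn (toℕ j)))) ⟩
        0# + sumFin (λ i → (K r (suc i) * sgn (toℕ j)) * δ i j)
          ≡⟨ trans (+-identityˡ _) (sum-δʳ (λ i → K r (suc i) * sgn (toℕ j)) j) ⟩
        K r (suc j) * sgn (toℕ j) ∎
        where open ≡-Reasoning

      K≡δ : ∀ i j → K (suc i) (suc j) ≡ δ i j
      K≡δ i j = *-cancelˡ (sgn≢0 (toℕ j))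
        (trans (*-comm _ _) (trans (sym (plain (suc i) j)) (trans (sym (MD′≡KMD (suc i) (j , false))) (*-comm _ _))))

      S′≡S+K : ∀ i j → S′ i j ≡ S i j + K (suc i) zero
      S′≡S+K i j = *-cancelˡ (sgn≢0 (toℕ j)) (begin
        sgn (toℕ j) * S′ i j
          ≡⟨ *-comm _ _ ⟩
        S′ i j * sgn (toℕ j)
          ≡⟨ MD′≡KMD (suc i) (j , true) ⟩
        K (suc i) zero * (1# * sgn (toℕ j)) + sumFin (λ i′ → K (suc i) (suc i′) * (S i′ j * sgn (toℕ j)))
          ≡⟨ cong₂ _+_ (cong (K (suc i) zero *_) (*-identityˡ _))
                       (trans (sum-cong {suc m} (λ i′ → cong (_* (S i′ j * sgn (toℕ j))) (K≡δ i i′))) (sum-δˡ (λ i′ → S i′ j * sgn (toℕ j)) i)) ⟩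
        K (suc i) zero * sgn (toℕ j) + S i j * sgn (toℕ j)
          ≡⟨ solve 3 (λ k s g → k :* g :+ s :* g := g :* (s :+ k)) refl (K (suc i) zero) (S i j) (sgn (toℕ j)) ⟩
        sgn (toℕ j) * (S i j + K (suc i) zero) ∎)
        where open ≡-Reasoning

  samePmat⇒rowShift : ∀ {m} (S S′ : Sq (suc m)) → (∀ a b → Pmat S′ a b ≡ Pmat S a b) → RowShift S S′
  samePmat⇒rowShift {m} S S′ P′≡P = (λ b → d b zero) , λ b a →
    trans (solve 2 (λ s s′ → s′ := s :+ (s′ :- s)) refl (S b a) (S′ b a)) (cong (S b a +_) (constant (d b) (step b) a))
    where
      d : Fin (suc m) → Fin (suc m) → Carrier
      d b a = S′ b a - S b a
      step : ∀ b (j : Fin m) → d b (suc j) ≡ d b (inject₁ j)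
      step b j = x-y≡0⇒x≡y (begin
        d b (suc j) - d b (inject₁ j)
          ≡⟨ solve 4 (λ x y u v → (y :- v) :- (x :- u) := (u :- v) :- (x :- y)) refl
                     (S′ b (inject₁ j)) (S′ b (suc j)) (S b (inject₁ j)) (S b (suc j)) ⟩
        (S b (inject₁ j) - S b (suc j)) - (S′ b (inject₁ j) - S′ b (suc j))
          ≡⟨ cong₂ (λ p q → q - p) (trans (cong (λ z → S′ b z - S′ b (suc j)) (sym (cpred-suc j))) (P′≡P (suc j) b))
                                   (cong (λ z → S b z - S b (suc j)) (sym (cpred-suc j))) ⟩
        Pmat S (suc j) b - Pmat S (suc j) b
          ≡⟨ -‿inverseʳ _ ⟩
        0# ∎)
        where open ≡-Reasoning

  tailSum : ∀ {k} → (Fin (suc k) → Carrier) → Fin (suc k) → Carrier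
  tailSum f zero = sumFin (λ i → f (suc i))
  tailSum {suc k} f (suc a) = tailSum (λ i → f (suc i)) a

  tailSum-fromℕ : ∀ {k} (f : Fin (suc k) → Carrier) → tailSum {k} f (fromℕ k) ≡ 0#
  tailSum-fromℕ {zero} f = refl
  tailSum-fromℕ {suc k} f = tailSum-fromℕ (λ i → f (suc i))

  tailSum-step : ∀ {k} (f : Fin (suc k) → Carrier) (j : Fin k) → tailSum f (inject₁ j) - tailSum f (suc j) ≡ f (suc j)
  tailSum-step {suc k} f zero = solve 2 (λ a b → (a :+ b) :- b := a) refl (f (suc zero)) (sumFin (λ i → f (suc (suc i))))
  tailSum-step {suc k} f (suc j) = tailSum-step (λ i → f (suc i)) j

  -- S b a = Σ_{a′ > a} P a′ b inverts the difference operator S ↦ Pmat S.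
  chartOf : ∀ {m} → Sq (suc m) → Sq (suc m)
  chartOf P b a = tailSum (λ a′ → P a′ b) a

  Pmat-chartOf : ∀ {m} (P : Sq (suc m)) → SymZeroSums P → ∀ a b → Pmat (chartOf P) a b ≡ P a b
  Pmat-chartOf {m} P (_ , _ , colSums) zero b = begin
    tailSum Pb (cpred zero) - tailSum Pb zero ≡⟨ cong (λ z → tailSum Pb z - tailSum Pb zero) cpred-zero ⟩
    tailSum Pb (fromℕ m) - tailSum Pb zero     ≡⟨ cong (_- tailSum Pb zero) (tailSum-fromℕ Pb) ⟩
    0# - sumFin (λ i → P (suc i) b)            ≡⟨ +-identityˡ _ ⟩
    - sumFin (λ i → P (suc i) b)               ≡⟨ sym (x+y≡0⇒x≡-y (colSums b)) ⟩
    P zero b                                   ∎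
    where
      open ≡-Reasoning
      Pb = λ a′ → P a′ b
  Pmat-chartOf P _ (suc j) b =
    trans (cong (λ z → tailSum (λ a′ → P a′ b) z - tailSum (λ a′ → P a′ b) (suc j)) (cpred-suc j)) (tailSum-step (λ a′ → P a′ b) j)

  det-firstRow : ∀ {k} (X : Sq (suc k)) → (∀ j → X zero (suc j) ≡ 0#) → det X ≡ 1# * X zero zero * det (minor₀ X zero)
  det-firstRow {k} X X₀≡0 = trans (cong (1# * X zero zero * det (minor₀ X zero) +_) (sum-zeros {k} λ j →
      trans (cong (λ q → sgn (toℕ (suc j)) * q * det (minor₀ X (suc j))) (X₀≡0 j)) (trans (cong (_* det (minor₀ X (suc j))) (zeroʳ _)) (zeroˡ _))))
    (+-identityʳ _)

  det-diagonal≢0 : ∀ {k} (d : Fin k → Carrier) → (∀ s → d s ≢ 0#) → det (λ r c → δ r c * d c) ≢ 0#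
  det-diagonal≢0 {zero} d _ = 1≢0
  det-diagonal≢0 {suc k} d d≢0 det≡0 = *-≢0 (*-≢0 1≢0 (*-≢0 (λ δ₀₀≡0 → 1≢0 (trans (sym (δ-refl {suc k} zero)) δ₀₀≡0)) (d≢0 zero))) minor≢0
    (trans (sym (det-firstRow (λ r c → δ r c * d c) (λ j → trans (cong (_* d (suc j)) (δ-zero-suc j)) (zeroˡ _)))) det≡0)
    where
      minor≢0 : det (minor₀ (λ r c → δ r c * d c) zero) ≢ 0#
      minor≢0 minor≡0 = det-diagonal≢0 (λ c → d (suc c)) (λ s → d≢0 (suc s))
        (trans (sym (det-cong (λ r c → cong (_* d (suc c)) (δ-suc r c)))) minor≡0)

  MD-minor≢0 : ∀ {m} (S : Sq (suc m)) k → minor (MD S) (colsNS k) ≢ 0#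
  MD-minor≢0 {m} S k minor≡0 = *-≢0 (*-≢0 1≢0 (*-≢0 1≢0 (sgn≢0 (toℕ k)))) (det-diagonal≢0 {suc m} (λ c → sgn (toℕ c)) (λ s → sgn≢0 (toℕ s)))
    (trans (sym (det-firstRow (λ r s → MD S r (colsNS k s)) (λ j → zeroˡ _))) minor≡0)

  sameSpan-isotropic : ∀ {m} {A B : Mat (suc m)} → SameSpan A B → Isotropic A → Isotropic B
  sameSpan-isotropic {A = A} {B} (_ , B∈A) = isotropic-rowCombination {X = B} {Y = A} B∈A

  MD-notShorted : ∀ {m} (S : Sq (suc m)) → (∀ a b → Pmat S a b ≡ Pmat S b a) → UNotShorted (MD S)
  MD-notShorted S P-sym = ((colsNS zero , MD-minor≢0 S zero) , MD-isotropic S P-sym) , MD-minor≢0 S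

  Pmat-chartOf-sym : ∀ {m} (P : Sq (suc m)) → SymZeroSums P → ∀ a b → Pmat (chartOf P) a b ≡ Pmat (chartOf P) b a
  Pmat-chartOf-sym P sz@(P-sym , _) a b =
    trans (Pmat-chartOf P sz a b) (trans (P-sym a b) (sym (Pmat-chartOf P sz b a)))

  MD-chart-unique : ∀ {m} {A : Mat (suc m)} {S : Sq (suc m)} → SameSpan A (MD S) →
    ∀ S′ → (SameSpan A (MD S′) → RowShift S S′) × (RowShift S S′ → SameSpan A (MD S′))
  MD-chart-unique {A = A} {S} A~MD S′ =
    (λ A~MD′ → sameSpan⇒rowShift S S′ (sameSpan-trans {X = MD S} (sameSpan-sym {X = A} A~MD) A~MD′)) ,
    (λ S~S′ → sameSpan-trans {X = A} A~MD (rowShift⇒sameSpan S S′ S~S′))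

  notShorted-chart : ∀ {m} (A : Mat (suc m)) → UNotShorted A →
    ∃ λ S → SameSpan A (MD S) ×
            (∀ S′ → (SameSpan A (MD S′) → RowShift S S′) × (RowShift S S′ → SameSpan A (MD S′))) ×
            SymZeroSums (Pmat S)
  notShorted-chart A ((_ , iso) , minors≢0) =
    let S , A~MD = MD-chart A iso (minors≢0 zero)
    in S , A~MD , MD-chart-unique A~MD , Pmat-symZeroSums S (sameSpan-isotropic {A = A} A~MD iso)

  notShorted-realisation : ∀ {m} (P : Sq (suc m)) → SymZeroSums P →
    ∃ λ A → UNotShorted A ×
            (∃ λ S → SameSpan A (MD S) × (∀ a b → Pmat S a b ≡ P a b)) ×
            (∀ A′ → UNotShorted A′ → (∃ λ S′ → SameSpan A′ (MD S′) × (∀ a b → Pmat S′ a b ≡ P a b)) → SameSpan A A′)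
  notShorted-realisation P sz =
    MD S , MD-notShorted S (Pmat-chartOf-sym P sz) , (S , sameSpan-refl (MD S) , Pmat-chartOf P sz) , unique
    where
      S = chartOf P
      unique : ∀ A′ → UNotShorted A′ → (∃ λ S′ → SameSpan A′ (MD S′) × (∀ a b → Pmat S′ a b ≡ P a b)) → SameSpan (MD S) A′
      unique A′ _ (S′ , A′~MD′ , P′≡P) =
        sameSpan-trans {X = MD S} (rowShift⇒sameSpan S S′ (samePmat⇒rowShift S S′ λ a b → trans (P′≡P a b) (sym (Pmat-chartOf P sz a b))))
                                  (sameSpan-sym {X = A′} A′~MD′)

  connected-chart : ∀ {m} (A : Mat (suc m)) → UConnected A → ∃ λ T → SameSpan A (M′D T) × SymZeroSums (Qmat T)
  connected-chart A ((_ , iso) , minors≢0) =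
    let T , A~M′D = M′D-chart A iso (minors≢0 zero)
    in T , A~M′D , Qmat-symZeroSums T (sameSpan-isotropic {A = A} A~M′D iso)

theorem1p2 : (ℝ : RealField) → let open Setup ℝ in
    ∀ (m : ℕ) →
      (∀ (A : Mat (suc m)) → UNotShorted A →
        ∃ λ (S : Sq (suc m)) →
          SameSpan A (timesD (M S)) ×
          (∀ (S′ : Sq (suc m)) → (SameSpan A (timesD (M S′)) → RowShift S S′)
                                × (RowShift S S′ → SameSpan A (timesD (M S′)))) ×
          SymZeroSums (Pmat S))
      ×
      (∀ (P : Sq (suc m)) → SymZeroSums P →
        ∃ λ (A : Mat (suc m)) → UNotShorted A ×
          (∃ λ (S : Sq (suc m)) → SameSpan A (timesD (M S)) × (∀ a b → Pmat S a b ≡ P a b)) ×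
          (∀ (A′ : Mat (suc m)) → UNotShorted A′ →
            (∃ λ (S′ : Sq (suc m)) → SameSpan A′ (timesD (M S′)) × (∀ a b → Pmat S′ a b ≡ P a b)) →
            SameSpan A A′))
      ×
      (∀ (A : Mat (suc m)) → UConnected A →
        ∃ λ (T : Sq (suc m)) →
          SameSpan A (timesD (M′ T)) × SymZeroSums (Qmat T))
theorem1p2 ℝ m = notShorted-chart , notShorted-realisation , connected-chart
  where open Charts ℝ
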